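{- Let $s,d_1, \dots, d_s,m$ be positive integers and let $\delta>\epsilon>0$. There exists $N$, depending only on $s,d_1,\dots,d_s,m,\delta,\epsilon$, such that for every $n\ge N$, whenever $\mathcal{A}_m$ is a non-empty subset of $\mathcal{P}([m]^{d_1} \cup \dots \cup [m]^{d_s})$ and $\mathcal{A} \subset \mathcal{P}([n]^{d_1} \cup \dots \cup [n]^{d_s})$ has density at least $\delta$, there exist an interval $I \subset [n]$ of size $m$ and a set $U \subset ([n]^{d_1} \setminus I^{d_1}) \cup \dots \cup ([n]^{d_s} \setminus I^{d_s})$ such that the collection \[\mathcal{C}(I,U)=\{A \in \mathcal{P}([n]^{d_1} \cup \dots \cup [n]^{d_s}): h_{I}(A \cap (I^{d_1} \cup \dots \cup I^{d_s})) \in \mathcal{A}_m,\ A \setminus (I^{d_1} \cup \dots \cup I^{d_s}) = U\}\] satisfies $|\mathcal{A} \cap \mathcal{C}(I,U)| \ge (\delta - \epsilon) |\mathcal{C}(I,U)|$. Moreover, there exists $N'$ depending only on $s,d_1,\dots,d_s,m,\delta$ such that if $n\ge N'$ and $|\mathcal{A}_m| > 4 \delta^{ -1}$, then for such $I,U$ the collection $\mathcal{C}(I,U)$ contains at least two elements of $\mathcal{A}$.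
   Context: $[n]=\{1,\dots,n\}$; unions such as $[n]^{d_1}\cup\dots\cup[n]^{d_s}$ are disjoint unions of $s$ copies. Density of $\mathcal{A}$ means $|\mathcal{A}|/2^{n^{d_1}+\dots+n^{d_s}}$. For an interval $I=\{l+1,\dots,l+m\}\subset[n]$ and $B\subset I^{d_1}\cup\dots\cup I^{d_s}$, $h_I(B)\subset[m]^{d_1}\cup\dots\cup[m]^{d_s}$ is obtained by replacing the coordinates $l+1,\dots,l+m$ by $1,\dots,m$ respectively in the elements of $B$. -}

module Defs where

open import Data.Nat using (ℕ; zero; suc; _+_; _*_; _^_; _≤_; _≤ᵇ_; _<ᵇ_)
open import Data.Bool using (Bool; true; false; _∧_; not; if_then_else_)
open import Data.Fin using (Fin; toℕ; inject≤; _↑ʳ_)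
open import Data.Vec using (Vec; []; _∷_; lookup; tabulate)
import Data.Vec as V
open import Data.List using (List; []; _∷_; concatMap; map)
open import Data.Product using (_×_; _,_)
open import Data.Sum using (_⊎_; inj₁; inj₂)
open import Data.Empty using (⊥)
open import Data.Unit using (⊤; tt)
open import Data.Integer using (+_)
open import Data.Rational using (ℚ; _/_)

-- Subsets of [n]^d, represented as d-dimensional Boolean arrays
-- (coordinates are 0-based: Fin n stands for [n] = {1,…,n}).

Cube : ℕ → ℕ → Set
Cube n zero    = Bool
Cube n (suc d) = Vec (Cube n d) n

memC : ∀ {n d} → Cube n d → Vec (Fin n) d → Bool
memC {d = zero}  b []       = b
memC {d = suc d} c (i ∷ is) = memC (lookup c i) is

tabC : ∀ {n d} → (Vec (Fin n) d → Bool) → Cube n d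
tabC {d = zero}  f = f []
tabC {d = suc d} f = tabulate (λ i → tabC (λ is → f (i ∷ is)))

eqC : ∀ {n d} → Cube n d → Cube n d → Bool
eqCs : ∀ {n d k} → Vec (Cube n d) k → Vec (Cube n d) k → Bool
eqC {d = zero}  true  true  = true
eqC {d = zero}  false false = true
eqC {d = zero}  _     _     = false
eqC {d = suc d} xs ys = eqCs xs ys
eqCs []       []       = true
eqCs (x ∷ xs) (y ∷ ys) = eqC x y ∧ eqCs xs ys

allVecs : ∀ {A : Set} → List A → (k : ℕ) → List (Vec A k)
allVecs xs zero    = [] ∷ []
allVecs xs (suc k) = concatMap (λ x → map (x ∷_) (allVecs xs k)) xs

allCubes : (n d : ℕ) → List (Cube n d)
allCubes n zero    = false ∷ true ∷ []
allCubes n (suc d) = allVecs (allCubes n d) n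

-- The ground set [n]^{d_1} ∪ … ∪ [n]^{d_s} (disjoint union) and its subsets.

Point : ℕ → ∀ {s} → Vec ℕ s → Set
Point n []       = ⊥
Point n (d ∷ ds) = Vec (Fin n) d ⊎ Point n ds

Config : ℕ → ∀ {s} → Vec ℕ s → Set
Config n []       = ⊤
Config n (d ∷ ds) = Cube n d × Config n ds

mem : ∀ {n s} {ds : Vec ℕ s} → Config n ds → Point n ds → Bool
mem {ds = d ∷ ds} (c , _) (inj₁ v) = memC c v
mem {ds = d ∷ ds} (_ , r) (inj₂ p) = mem r p

tab : ∀ {n s} {ds : Vec ℕ s} → (Point n ds → Bool) → Config n ds
tab {ds = []}     f = tt
tab {ds = d ∷ ds} f = tabC (λ v → f (inj₁ v)) , tab (λ p → f (inj₂ p))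

eqConfig : ∀ {n s} {ds : Vec ℕ s} → Config n ds → Config n ds → Bool
eqConfig {ds = []}     _        _        = true
eqConfig {ds = d ∷ ds} (c , r) (c' , r') = eqC c c' ∧ eqConfig r r'

allConfigs : (n : ℕ) → ∀ {s} (ds : Vec ℕ s) → List (Config n ds)
allConfigs n []       = tt ∷ []
allConfigs n (d ∷ ds) = concatMap (λ c → map (c ,_) (allConfigs n ds)) (allCubes n d)

groundSize : ℕ → ∀ {s} → Vec ℕ s → ℕ
groundSize n []       = 0
groundSize n (d ∷ ds) = n ^ d + groundSize n ds

Family : ℕ → ∀ {s} → Vec ℕ s → Set
Family n ds = Config n ds → Bool

countTrue : ∀ {A : Set} → (A → Bool) → List A → ℕ
countTrue P []       = 0
countTrue P (x ∷ xs) = if P x then suc (countTrue P xs) else countTrue P xs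

card : ∀ {n s} {ds : Vec ℕ s} → Family n ds → ℕ
card {n} {ds = ds} 𝒜 = countTrue 𝒜 (allConfigs n ds)

_∩F_ : ∀ {n s} {ds : Vec ℕ s} → Family n ds → Family n ds → Family n ds
(𝒜 ∩F ℬ) A = 𝒜 A ∧ ℬ A

toℚ : ℕ → ℚ
toℚ k = + k / 1

-- Intervals I = {l+1,…,l+m} ⊂ [n]  (0-based: Fin-indices l,…,l+m-1), l+m ≤ n.

-- the map [m] → I, j ↦ l + j  (inverse of h_I on coordinates)
embI : ∀ {n} (l m : ℕ) → l + m ≤ n → Fin m → Fin n
embI l m h j = inject≤ (l ↑ʳ j) h

embPoint : ∀ {n s} {ds : Vec ℕ s} (l m : ℕ) → l + m ≤ n → Point m ds → Point n ds
embPoint {ds = d ∷ ds} l m h (inj₁ v) = inj₁ (V.map (embI l m h) v)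
embPoint {ds = d ∷ ds} l m h (inj₂ p) = inj₂ (embPoint l m h p)

inIntervalᵇ : ∀ {n} (l m : ℕ) → Fin n → Bool
inIntervalᵇ l m x = (l ≤ᵇ toℕ x) ∧ (toℕ x <ᵇ l + m)

inIᵇ : ∀ {n s} {ds : Vec ℕ s} (l m : ℕ) → Point n ds → Bool
inIᵇ {ds = d ∷ ds} l m (inj₁ v) = V.foldr _ (λ x b → inIntervalᵇ l m x ∧ b) true v
inIᵇ {ds = d ∷ ds} l m (inj₂ p) = inIᵇ l m p

-- h_I (A ∩ (I^{d_1} ∪ … ∪ I^{d_s})) ⊂ [m]^{d_1} ∪ … ∪ [m]^{d_s}
hI : ∀ {n s} {ds : Vec ℕ s} (l m : ℕ) → l + m ≤ n → Config n ds → Config m ds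
hI l m h A = tab (λ q → mem A (embPoint l m h q))

outsideI : ∀ {n s} {ds : Vec ℕ s} (l m : ℕ) → Config n ds → Config n ds
outsideI l m A = tab (λ p → mem A p ∧ not (inIᵇ l m p))

𝒞 : ∀ {n s} {ds : Vec ℕ s} (m : ℕ) → Family m ds → (l : ℕ) → l + m ≤ n →
    Config n ds → Family n ds
𝒞 m 𝒜m l h U A = 𝒜m (hI l m h A) ∧ eqConfig (outsideI l m A) U

-- Density increment.  Cut [n] into consecutive intervals I₀, I₁, … of length m and let q be the
-- number of patterns on I^{d₁} ∪ … ∪ I^{d_s}.  Suppose 𝒜 has density at least ρ/D in a family F
-- that only constrains coordinates in earlier intervals.  Splitting a configuration into its
-- pattern on I_j and its part U off I_j, either some 𝒞(I_j,U) has density at least α/D, or some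
-- pattern c fixed on I_j raises the density in F to (ρ+1)/D: otherwise averaging over the
-- patterns in 𝒜m and outside it would give density below (α|𝒜m| + (ρ+1)(q − |𝒜m|))/(qD) ≤ ρ/D
-- when α + q ≤ ρ.  The refined family again only constrains earlier intervals and densities are
-- at most 1, so D + 1 intervals suffice.  The theorem takes ρ/D = δ and α/D = δ − ε (resp. δ/2),
-- with numerators and denominator scaled by q.

{-# OPTIONS --safe #-}
module Submission where

open import Defs
open import Data.Nat using (ℕ; _+_; _≤_; _^_)
open import Data.Vec using (Vec)
open import Data.Vec.Relation.Unary.All using (All)
open import Data.Product using (Σ; _×_; _,_)
open import Data.Bool using (T; false)
open import Relation.Binary.PropositionalEquality using (_≡_)
open import Data.Rational using (ℚ; 0ℚ) renaming (_<_ to _<ℚ_; _≤_ to _≤ℚ_; _*_ to _*ℚ_; _-_ to _-ℚ_)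

open import Data.Bool using (Bool; true; _∧_; not; if_then_else_)
import Data.Bool.Properties as Boolₚ
open import Data.Empty using (⊥-elim)
open import Data.Fin using (Fin; toℕ)
import Data.Fin.Properties as Finₚ
open import Data.Integer as ℤ using (-[1+_]; +≤+; +<+) renaming (+_ to ⁺_)
import Data.Integer.Properties as ℤₚ
import Data.Integer.Tactic.RingSolver as ℤ-Solver
open import Data.List using (List; []; _∷_; _++_; concatMap; map)
import Data.List.Relation.Unary.All as ListAll
open import Data.List.Relation.Unary.All.Properties using (¬Any⇒All¬)
open import Data.List.Relation.Unary.Any using (any?; satisfied)
open import Data.Nat using (zero; suc; _*_; _∸_; _<_; _≤?_; z≤n; s≤s; NonZero; >-nonZero; >-nonZero⁻¹; _≤ᵇ_; _<ᵇ_)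
open import Data.Nat.Coprimality using (1-coprimeTo) renaming (sym to coprime-sym)
open import Data.Nat.DivMod using (_mod_; m<n⇒m%n≡m)
open import Data.Nat.Properties
open import Algebra.Properties.CommutativeSemigroup *-commutativeSemigroup
  using (x∙yz≈y∙xz; x∙yz≈y∙zx; x∙yz≈z∙xy)
open import Algebra.Properties.CommutativeSemigroup +-commutativeSemigroup
  using () renaming (interchange to +-interchange)
open import Data.Nat.Tactic.RingSolver using (solve-∀)
import Data.Rational as ℚ
open import Data.Rational using (mkℚ; toℚᵘ)
import Data.Rational.Properties as ℚₚ
open import Data.Rational.Unnormalised using (mkℚᵘ; *≤*; *<*) renaming (_≃_ to _≃ᵘ_; _≤_ to _≤ᵘ_; _<_ to _<ᵘ_)
import Data.Rational.Unnormalised.Properties as ℚᵘₚ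
open import Data.Sum using (_⊎_; inj₁; inj₂; [_,_]′)
open import Data.Unit using (tt)
open import Data.Vec.Relation.Unary.All using ([]; _∷_)
import Data.Vec as V
open import Data.Vec using ([]; _∷_; lookup; tabulate)
import Data.Vec.Properties as Vecₚ
open import Function using (_∘_; id; _⇔_; mk⇔; Equivalence)
open Equivalence using (to; from)
open import Relation.Binary.PropositionalEquality using (refl; sym; trans; cong; cong₂; subst; subst₂; module ≡-Reasoning)
open import Relation.Nullary using (¬_; contradiction; yes; no)
open import Relation.Nullary.Decidable using (_×-dec_)

-- Finite sums over lists

⟦_⟧ : Bool → ℕ
⟦ true ⟧  = 1
⟦ false ⟧ = 0

∑ : ∀ {A : Set} → List A → (A → ℕ) → ℕ
∑ []       f = 0
∑ (x ∷ xs) f = f x + ∑ xs f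

syntax ∑ xs (λ x → e) = ∑[ x ∈ xs ] e

⟦∧⟧ : ∀ a b → ⟦ a ∧ b ⟧ ≡ ⟦ a ⟧ * ⟦ b ⟧
⟦∧⟧ true  b = sym (+-identityʳ ⟦ b ⟧)
⟦∧⟧ false b = refl

⟦⟧+⟦not⟧ : ∀ a → ⟦ a ⟧ + ⟦ not a ⟧ ≡ 1
⟦⟧+⟦not⟧ true  = refl
⟦⟧+⟦not⟧ false = refl

bool-ext : ∀ {a b : Bool} → (a ≡ true → b ≡ true) → (b ≡ true → a ≡ true) → a ≡ b
bool-ext {true}  {true}  _ _ = refl
bool-ext {true}  {false} a⇒b _ = sym (a⇒b refl)
bool-ext {false} {true}  _ b⇒a = b⇒a refl
bool-ext {false} {false} _ _ = refl

∧-true : ∀ {a b} → a ∧ b ≡ true → (a ≡ true) × (b ≡ true)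
∧-true {true} {true} refl = refl , refl

private variable
  A B C : Set

∑-cong : (xs : List A) {f g : A → ℕ} → (∀ x → f x ≡ g x) → ∑ xs f ≡ ∑ xs g
∑-cong []       f≗g = refl
∑-cong (x ∷ xs) f≗g = cong₂ _+_ (f≗g x) (∑-cong xs f≗g)

∑-mono : (xs : List A) {f g : A → ℕ} → (∀ x → f x ≤ g x) → ∑ xs f ≤ ∑ xs g
∑-mono []       f≤g = z≤n
∑-mono (x ∷ xs) f≤g = +-mono-≤ (f≤g x) (∑-mono xs f≤g)

∑-zero : (xs : List A) → ∑[ x ∈ xs ] 0 ≡ 0
∑-zero []       = refl
∑-zero (x ∷ xs) = ∑-zero xs

∑-distrib-+ : (xs : List A) (f g : A → ℕ) → ∑[ x ∈ xs ] (f x + g x) ≡ ∑ xs f + ∑ xs g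
∑-distrib-+ []       f g = refl
∑-distrib-+ (x ∷ xs) f g = begin
  f x + g x + ∑[ y ∈ xs ] (f y + g y)  ≡⟨ cong (f x + g x +_) (∑-distrib-+ xs f g) ⟩
  f x + g x + (∑ xs f + ∑ xs g)        ≡⟨ +-interchange (f x) (g x) (∑ xs f) (∑ xs g) ⟩
  f x + ∑ xs f + (g x + ∑ xs g)        ∎
  where open ≡-Reasoning

∑-*ˡ : (c : ℕ) (xs : List A) (f : A → ℕ) → ∑[ x ∈ xs ] (c * f x) ≡ c * ∑ xs f
∑-*ˡ c []       f = sym (*-zeroʳ c)
∑-*ˡ c (x ∷ xs) f = trans (cong (c * f x +_) (∑-*ˡ c xs f)) (sym (*-distribˡ-+ c (f x) (∑ xs f)))

∑-*ʳ : (c : ℕ) (xs : List A) (f : A → ℕ) → ∑[ x ∈ xs ] (f x * c) ≡ ∑ xs f * c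
∑-*ʳ c xs f = trans (∑-cong xs (λ x → *-comm (f x) c)) (trans (∑-*ˡ c xs f) (*-comm c (∑ xs f)))

∑-++ : (xs ys : List A) (f : A → ℕ) → ∑ (xs ++ ys) f ≡ ∑ xs f + ∑ ys f
∑-++ []       ys f = refl
∑-++ (x ∷ xs) ys f = trans (cong (f x +_) (∑-++ xs ys f)) (sym (+-assoc (f x) (∑ xs f) (∑ ys f)))

∑-comm : (xs : List A) (ys : List B) (f : A → B → ℕ) →
         ∑[ x ∈ xs ] ∑[ y ∈ ys ] f x y ≡ ∑[ y ∈ ys ] ∑[ x ∈ xs ] f x y
∑-comm []       ys f = sym (∑-zero ys)
∑-comm (x ∷ xs) ys f = trans (cong (∑ ys (f x) +_) (∑-comm xs ys f))
                             (sym (∑-distrib-+ ys (f x) (λ y → ∑[ x′ ∈ xs ] f x′ y)))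

∑-pairs : (g : A → B → C) (xs : List A) (ys : List B) (f : C → ℕ) →
          ∑ (concatMap (λ x → map (g x) ys) xs) f ≡ ∑[ x ∈ xs ] ∑[ y ∈ ys ] f (g x y)
∑-pairs g []       ys f = refl
∑-pairs g (x ∷ xs) ys f = begin
  ∑ (map (g x) ys ++ concatMap (λ x → map (g x) ys) xs) f ≡⟨ ∑-++ (map (g x) ys) _ f ⟩
  ∑ (map (g x) ys) f + ∑ (concatMap (λ x → map (g x) ys) xs) f
    ≡⟨ cong₂ _+_ (∑-map ys) (∑-pairs g xs ys f) ⟩
  ∑[ y ∈ ys ] f (g x y) + ∑[ x ∈ xs ] ∑[ y ∈ ys ] f (g x y) ∎
  where
  open ≡-Reasoning
  ∑-map : ∀ ys → ∑ (map (g x) ys) f ≡ ∑[ y ∈ ys ] f (g x y)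
  ∑-map []       = refl
  ∑-map (y ∷ ys) = cong (f (g x y) +_) (∑-map ys)

∑-weighted-< : (xs : List A) (w : A → Bool) (f g : A → ℕ) → ListAll.All (λ x → w x ≡ true → f x < g x) xs →
               ∑[ x ∈ xs ] (⟦ w x ⟧ * f x) + ∑[ x ∈ xs ] ⟦ w x ⟧ ≤ ∑[ x ∈ xs ] (⟦ w x ⟧ * g x)
∑-weighted-< []       w f g ListAll.[]          = z≤n
∑-weighted-< (x ∷ xs) w f g (fx<gx ListAll.∷ ps) = begin
  (⟦ w x ⟧ * f x + ∑[ y ∈ xs ] (⟦ w y ⟧ * f y)) + (⟦ w x ⟧ + ∑[ y ∈ xs ] ⟦ w y ⟧)
    ≡⟨ +-interchange (⟦ w x ⟧ * f x) _ ⟦ w x ⟧ _ ⟩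
  (⟦ w x ⟧ * f x + ⟦ w x ⟧) + (∑[ y ∈ xs ] (⟦ w y ⟧ * f y) + ∑[ y ∈ xs ] ⟦ w y ⟧)
    ≤⟨ +-mono-≤ (at-x (w x) refl) (∑-weighted-< xs w f g ps) ⟩
  ⟦ w x ⟧ * g x + ∑[ y ∈ xs ] (⟦ w y ⟧ * g y) ∎
  where
  open ≤-Reasoning
  at-x : ∀ b → w x ≡ b → ⟦ b ⟧ * f x + ⟦ b ⟧ ≤ ⟦ b ⟧ * g x
  at-x true  wx = subst₂ _≤_ (sym (trans (cong (_+ 1) (+-identityʳ (f x))) (+-comm (f x) 1))) (sym (+-identityʳ (g x))) (fx<gx wx)
  at-x false _  = z≤n

∑-partition : (xs : List A) (b : A → Bool) (f : A → ℕ) →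
              ∑ xs f ≡ ∑[ x ∈ xs ] (⟦ b x ⟧ * f x) + ∑[ x ∈ xs ] (⟦ not (b x) ⟧ * f x)
∑-partition xs b f = trans (∑-cong xs split) (∑-distrib-+ xs _ _)
  where
  split : ∀ x → f x ≡ ⟦ b x ⟧ * f x + ⟦ not (b x) ⟧ * f x
  split x = sym (trans (sym (*-distribʳ-+ (f x) ⟦ b x ⟧ _)) (trans (cong (_* f x) (⟦⟧+⟦not⟧ (b x))) (*-identityˡ (f x))))

countTrue≡∑ : (P : A → Bool) (xs : List A) → countTrue P xs ≡ ∑[ x ∈ xs ] ⟦ P x ⟧
countTrue≡∑ P []       = refl
countTrue≡∑ P (x ∷ xs) with P x
... | true  = cong suc (countTrue≡∑ P xs)
... | false = countTrue≡∑ P xs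

∑-pairs-∧ : (g : A → B → C) (xs : List A) (ys : List B) (R : C → Bool) (P : A → Bool) (Q : B → Bool) →
            (∀ x y → R (g x y) ≡ P x ∧ Q y) →
            ∑[ z ∈ concatMap (λ x → map (g x) ys) xs ] ⟦ R z ⟧ ≡ ∑[ x ∈ xs ] ⟦ P x ⟧ * ∑[ y ∈ ys ] ⟦ Q y ⟧
∑-pairs-∧ g xs ys R P Q R≡P∧Q = begin
  ∑[ z ∈ concatMap (λ x → map (g x) ys) xs ] ⟦ R z ⟧     ≡⟨ ∑-pairs g xs ys (λ z → ⟦ R z ⟧) ⟩
  ∑[ x ∈ xs ] ∑[ y ∈ ys ] ⟦ R (g x y) ⟧                 ≡⟨ ∑-cong xs (λ x → ∑-cong ys (λ y →
                                                             trans (cong ⟦_⟧ (R≡P∧Q x y)) (⟦∧⟧ (P x) (Q y)))) ⟩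
  ∑[ x ∈ xs ] ∑[ y ∈ ys ] (⟦ P x ⟧ * ⟦ Q y ⟧)           ≡⟨ ∑-cong xs (λ x → ∑-*ˡ ⟦ P x ⟧ ys (λ y → ⟦ Q y ⟧)) ⟩
  ∑[ x ∈ xs ] (⟦ P x ⟧ * ∑[ y ∈ ys ] ⟦ Q y ⟧)           ≡⟨ ∑-*ʳ _ xs (λ x → ⟦ P x ⟧) ⟩
  ∑[ x ∈ xs ] ⟦ P x ⟧ * ∑[ y ∈ ys ] ⟦ Q y ⟧             ∎
  where open ≡-Reasoning

∑-pairs-const : (g : A → B → C) (xs : List A) (ys : List B) →
                ∑[ z ∈ concatMap (λ x → map (g x) ys) xs ] 1 ≡ ∑[ x ∈ xs ] 1 * ∑[ y ∈ ys ] 1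
∑-pairs-const g xs ys = ∑-pairs-∧ g xs ys (λ _ → true) (λ _ → true) (λ _ → true) (λ _ _ → refl)

Enumerates : (A → A → Bool) → List A → Set
Enumerates _==_ xs = ∀ x → ∑[ y ∈ xs ] ⟦ x == y ⟧ ≡ 1

∑-enumerates : (_==_ : A → A → Bool) {xs : List A} → Enumerates _==_ xs →
               (∀ {x y} → x == y ≡ true → x ≡ y) →
               ∀ x (f : A → ℕ) → ∑[ y ∈ xs ] (⟦ x == y ⟧ * f y) ≡ f x
∑-enumerates _==_ {xs} once sound x f = begin
  ∑[ y ∈ xs ] (⟦ x == y ⟧ * f y)  ≡⟨ ∑-cong xs only-x ⟩
  ∑[ y ∈ xs ] (⟦ x == y ⟧ * f x)  ≡⟨ ∑-*ʳ (f x) xs (λ y → ⟦ x == y ⟧) ⟩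
  ∑[ y ∈ xs ] ⟦ x == y ⟧ * f x    ≡⟨ cong (_* f x) (once x) ⟩
  1 * f x                         ≡⟨ *-identityˡ (f x) ⟩
  f x                             ∎
  where
  open ≡-Reasoning
  only-x : ∀ y → ⟦ x == y ⟧ * f y ≡ ⟦ x == y ⟧ * f x
  only-x y with x == y in eq
  ... | true  = cong (λ z → 1 * f z) (sym (sound eq))
  ... | false = refl

-- Configurations

memC-tabC : ∀ {n d} (f : Vec (Fin n) d → Bool) is → memC (tabC f) is ≡ f is
memC-tabC {d = zero}  f []       = refl
memC-tabC {d = suc d} f (i ∷ is) =
  trans (cong (λ c → memC c is) (Vecₚ.lookup∘tabulate _ i)) (memC-tabC (λ js → f (i ∷ js)) is)

mem-tab : ∀ {n s} {ds : Vec ℕ s} (f : Point n ds → Bool) p → mem (tab f) p ≡ f p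
mem-tab {ds = d ∷ ds} f (inj₁ v) = memC-tabC (λ v → f (inj₁ v)) v
mem-tab {ds = d ∷ ds} f (inj₂ p) = mem-tab (λ p → f (inj₂ p)) p

Cube-ext : ∀ {n d} (c c′ : Cube n d) → (∀ is → memC c is ≡ memC c′ is) → c ≡ c′
Cube-ext {d = zero}  c c′ c≗c′ = c≗c′ []
Cube-ext {d = suc d} c c′ c≗c′ = begin
  c                     ≡⟨ Vecₚ.tabulate∘lookup c ⟨
  tabulate (lookup c)   ≡⟨ Vecₚ.tabulate-cong (λ i → Cube-ext (lookup c i) (lookup c′ i) (λ is → c≗c′ (i ∷ is))) ⟩
  tabulate (lookup c′)  ≡⟨ Vecₚ.tabulate∘lookup c′ ⟩
  c′                    ∎
  where open ≡-Reasoning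

Config-ext : ∀ {n s} {ds : Vec ℕ s} (c c′ : Config n ds) → (∀ p → mem c p ≡ mem c′ p) → c ≡ c′
Config-ext {ds = []}     tt      tt        _     = refl
Config-ext {ds = d ∷ ds} (c , r) (c′ , r′) c≗c′ =
  cong₂ _,_ (Cube-ext c c′ (λ v → c≗c′ (inj₁ v))) (Config-ext r r′ (λ p → c≗c′ (inj₂ p)))

eqC-sound : ∀ {n d} {x y : Cube n d} → eqC x y ≡ true → x ≡ y
eqCs-sound : ∀ {n d k} {x y : Vec (Cube n d) k} → eqCs x y ≡ true → x ≡ y
eqC-sound {d = zero}  {true}  {true}  _ = refl
eqC-sound {d = zero}  {false} {false} _ = refl
eqC-sound {d = suc d} x==y = eqCs-sound x==y
eqCs-sound {x = []}     {[]}     _ = refl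
eqCs-sound {x = x ∷ xs} {y ∷ ys} eq with ∧-true {eqC x y} eq
... | x==y , xs==ys = cong₂ _∷_ (eqC-sound x==y) (eqCs-sound xs==ys)

eqC-refl : ∀ {n d} (x : Cube n d) → eqC x x ≡ true
eqCs-refl : ∀ {n d k} (x : Vec (Cube n d) k) → eqCs x x ≡ true
eqC-refl {d = zero}  true  = refl
eqC-refl {d = zero}  false = refl
eqC-refl {d = suc d} x     = eqCs-refl x
eqCs-refl []       = refl
eqCs-refl (x ∷ xs) = cong₂ _∧_ (eqC-refl x) (eqCs-refl xs)

eqConfig-sound : ∀ {n s} {ds : Vec ℕ s} {x y : Config n ds} → eqConfig x y ≡ true → x ≡ y
eqConfig-sound {ds = []}     {tt}    {tt}      _ = refl
eqConfig-sound {ds = d ∷ ds} {c , r} {c′ , r′} eq with ∧-true {eqC c c′} eq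
... | c==c′ , r==r′ = cong₂ _,_ (eqC-sound c==c′) (eqConfig-sound r==r′)

eqConfig-complete : ∀ {n s} {ds : Vec ℕ s} {x y : Config n ds} → x ≡ y → eqConfig x y ≡ true
eqConfig-complete {ds = []}     {tt}    refl = refl
eqConfig-complete {ds = d ∷ ds} {c , r} refl = cong₂ _∧_ (eqC-refl c) (eqConfig-complete {x = r} refl)

eqConfig-sym : ∀ {n s} {ds : Vec ℕ s} (x y : Config n ds) → eqConfig x y ≡ eqConfig y x
eqConfig-sym {ds = ds} x y = bool-ext (λ eq → eqConfig-complete {ds = ds} (sym (eqConfig-sound eq)))
                                      (λ eq → eqConfig-complete {ds = ds} (sym (eqConfig-sound eq)))

allVecs-enumerates : ∀ {n d} → Enumerates eqC (allCubes n d) →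
                     ∀ k → Enumerates (eqCs {k = k}) (allVecs (allCubes n d) k)
allVecs-enumerates once zero    []       = refl
allVecs-enumerates {n} {d} once (suc k) (c ∷ cs) =
  trans (∑-pairs-∧ _∷_ (allCubes n d) (allVecs (allCubes n d) k) (eqCs (c ∷ cs)) (eqC c) (eqCs cs) (λ _ _ → refl))
        (cong₂ _*_ (once c) (allVecs-enumerates once k cs))

allCubes-enumerates : ∀ n d → Enumerates eqC (allCubes n d)
allCubes-enumerates n zero    true  = refl
allCubes-enumerates n zero    false = refl
allCubes-enumerates n (suc d) c     = allVecs-enumerates (allCubes-enumerates n d) n c

allConfigs-enumerates : ∀ n {s} (ds : Vec ℕ s) → Enumerates eqConfig (allConfigs n ds)
allConfigs-enumerates n []       tt      = refl
allConfigs-enumerates n (d ∷ ds) (c , r) =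
  trans (∑-pairs-∧ _,_ (allCubes n d) (allConfigs n ds) (eqConfig (c , r)) (eqC c) (eqConfig r) (λ _ _ → refl))
        (cong₂ _*_ (allCubes-enumerates n d c) (allConfigs-enumerates n ds r))

∑-allConfigs-eq : ∀ n {s} (ds : Vec ℕ s) (x : Config n ds) (f : Config n ds → ℕ) →
                  ∑[ y ∈ allConfigs n ds ] (⟦ eqConfig x y ⟧ * f y) ≡ f x
∑-allConfigs-eq n ds = ∑-enumerates eqConfig {allConfigs n ds} (allConfigs-enumerates n ds) eqConfig-sound

size-allVecs : (xs : List A) (k : ℕ) → ∑[ _ ∈ allVecs xs k ] 1 ≡ (∑[ _ ∈ xs ] 1) ^ k
size-allVecs xs zero    = refl
size-allVecs xs (suc k) = trans (∑-pairs-const _∷_ xs (allVecs xs k)) (cong (∑[ _ ∈ xs ] 1 *_) (size-allVecs xs k))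

size-allCubes : ∀ n d → ∑[ _ ∈ allCubes n d ] 1 ≡ 2 ^ (n ^ d)
size-allCubes n zero    = refl
size-allCubes n (suc d) = begin
  ∑[ _ ∈ allVecs (allCubes n d) n ] 1  ≡⟨ size-allVecs (allCubes n d) n ⟩
  (∑[ _ ∈ allCubes n d ] 1) ^ n        ≡⟨ cong (_^ n) (size-allCubes n d) ⟩
  (2 ^ (n ^ d)) ^ n                    ≡⟨ ^-*-assoc 2 (n ^ d) n ⟩
  2 ^ (n ^ d * n)                      ≡⟨ cong (2 ^_) (*-comm (n ^ d) n) ⟩
  2 ^ (n * n ^ d)                      ∎
  where open ≡-Reasoning

size-allConfigs : ∀ n {s} (ds : Vec ℕ s) → ∑[ _ ∈ allConfigs n ds ] 1 ≡ 2 ^ groundSize n ds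
size-allConfigs n []       = refl
size-allConfigs n (d ∷ ds) = begin
  ∑[ _ ∈ allConfigs n (d ∷ ds) ] 1                           ≡⟨ ∑-pairs-const _,_ (allCubes n d) (allConfigs n ds) ⟩
  ∑[ _ ∈ allCubes n d ] 1 * ∑[ _ ∈ allConfigs n ds ] 1        ≡⟨ cong₂ _*_ (size-allCubes n d) (size-allConfigs n ds) ⟩
  2 ^ (n ^ d) * 2 ^ groundSize n ds                          ≡⟨ ^-distribˡ-+-* 2 (n ^ d) (groundSize n ds) ⟨
  2 ^ (n ^ d + groundSize n ds)                              ∎
  where open ≡-Reasoning

card≡∑ : ∀ {n s} {ds : Vec ℕ s} (F : Family n ds) → card F ≡ ∑[ x ∈ allConfigs n ds ] ⟦ F x ⟧
card≡∑ {n} {ds = ds} F = countTrue≡∑ F (allConfigs n ds)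

card-full : ∀ {n s} (ds : Vec ℕ s) → card {n} {ds = ds} (λ _ → true) ≡ 2 ^ groundSize n ds
card-full {n} ds = trans (card≡∑ {ds = ds} (λ _ → true)) (size-allConfigs n ds)

card-cong : ∀ {n s} {ds : Vec ℕ s} {F G : Family n ds} → (∀ x → F x ≡ G x) → card F ≡ card G
card-cong {n} {ds = ds} {F} {G} F≗G =
  trans (card≡∑ F) (trans (∑-cong (allConfigs n ds) (λ x → cong ⟦_⟧ (F≗G x))) (sym (card≡∑ G)))

∑-fibres : ∀ {n s} {ds : Vec ℕ s} (ys : List B) (zs : List C) (w : B → ℕ) (g : B → C → Config n ds) →
           (∀ x → ∑[ y ∈ ys ] (w y * ∑[ z ∈ zs ] ⟦ eqConfig x (g y z) ⟧) ≡ 1) →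
           (f : Config n ds → ℕ) → ∑[ x ∈ allConfigs n ds ] f x ≡ ∑[ y ∈ ys ] (w y * ∑[ z ∈ zs ] f (g y z))
∑-fibres {n = n} {ds = ds} ys zs w g one-fibre f = begin
  ∑[ x ∈ xs ] f x
    ≡⟨ ∑-cong xs (λ x → trans (sym (*-identityʳ (f x))) (cong (f x *_) (sym (one-fibre x)))) ⟩
  ∑[ x ∈ xs ] (f x * ∑[ y ∈ ys ] (w y * ∑[ z ∈ zs ] ⟦ eqConfig x (g y z) ⟧))
    ≡⟨ ∑-cong xs (λ x → distribute (f x) x) ⟩
  ∑[ x ∈ xs ] ∑[ y ∈ ys ] ∑[ z ∈ zs ] (w y * (⟦ eqConfig (g y z) x ⟧ * f x))
    ≡⟨ ∑-comm xs ys _ ⟩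
  ∑[ y ∈ ys ] ∑[ x ∈ xs ] ∑[ z ∈ zs ] (w y * (⟦ eqConfig (g y z) x ⟧ * f x))
    ≡⟨ ∑-cong ys (λ y → ∑-comm xs zs _) ⟩
  ∑[ y ∈ ys ] ∑[ z ∈ zs ] ∑[ x ∈ xs ] (w y * (⟦ eqConfig (g y z) x ⟧ * f x))
    ≡⟨ ∑-cong ys (λ y → ∑-cong zs (λ z → trans (∑-*ˡ (w y) xs _) (cong (w y *_) (∑-allConfigs-eq n ds (g y z) f)))) ⟩
  ∑[ y ∈ ys ] ∑[ z ∈ zs ] (w y * f (g y z))
    ≡⟨ ∑-cong ys (λ y → ∑-*ˡ (w y) zs (λ z → f (g y z))) ⟩
  ∑[ y ∈ ys ] (w y * ∑[ z ∈ zs ] f (g y z))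
    ∎
  where
  open ≡-Reasoning
  xs = allConfigs n ds
  distribute : ∀ c x → c * ∑[ y ∈ ys ] (w y * ∑[ z ∈ zs ] ⟦ eqConfig x (g y z) ⟧) ≡
                       ∑[ y ∈ ys ] ∑[ z ∈ zs ] (w y * (⟦ eqConfig (g y z) x ⟧ * c))
  distribute c x = begin
    c * ∑[ y ∈ ys ] (w y * ∑[ z ∈ zs ] ⟦ eqConfig x (g y z) ⟧)  ≡⟨ ∑-*ˡ c ys _ ⟨
    ∑[ y ∈ ys ] (c * (w y * ∑[ z ∈ zs ] ⟦ eqConfig x (g y z) ⟧)) ≡⟨ ∑-cong ys (λ y → trans
      (cong (c *_) (sym (∑-*ˡ (w y) zs _))) (sym (∑-*ˡ c zs _))) ⟩
    ∑[ y ∈ ys ] ∑[ z ∈ zs ] (c * (w y * ⟦ eqConfig x (g y z) ⟧))  ≡⟨ ∑-cong ys (λ y → ∑-cong zs (λ z →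
      trans (x∙yz≈y∙zx c (w y) ⟦ eqConfig x (g y z) ⟧) (cong (λ t → w y * (⟦ t ⟧ * c)) (eqConfig-sym x (g y z))))) ⟩
    ∑[ y ∈ ys ] ∑[ z ∈ zs ] (w y * (⟦ eqConfig (g y z) x ⟧ * c)) ∎

-- Embedding an interval

toℕ-embI : ∀ {n} l m (h : l + m ≤ n) (j : Fin m) → toℕ (embI l m h j) ≡ l + toℕ j
toℕ-embI l m h j = trans (Finₚ.toℕ-inject≤ _ h) (Finₚ.toℕ-↑ʳ l j)

inIntervalᵇ-embI : ∀ {n} l m (h : l + m ≤ n) (j : Fin m) → inIntervalᵇ l m (embI l m h j) ≡ true
inIntervalᵇ-embI l m h j rewrite toℕ-embI l m h j =
  cong₂ _∧_ (Boolₚ.T-≡ .to (≤⇒≤ᵇ (m≤m+n l (toℕ j)))) (Boolₚ.T-≡ .to (<⇒<ᵇ (+-monoʳ-< l (Finₚ.toℕ<n j))))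

inIntervalᵇ-bounds : ∀ {n} l m {x : Fin n} → inIntervalᵇ l m x ≡ true → l ≤ toℕ x × toℕ x < l + m
inIntervalᵇ-bounds l m {x} inI with ∧-true {l ≤ᵇ toℕ x} inI
... | l≤x , x<l+m = ≤ᵇ⇒≤ l (toℕ x) (Boolₚ.T-≡ .from l≤x) , <ᵇ⇒< (toℕ x) (l + m) (Boolₚ.T-≡ .from x<l+m)

Disjoint : ℕ → ℕ → ℕ → Set
Disjoint l l′ m = (l + m ≤ l′) ⊎ (l′ + m ≤ l)

inIntervalᵇ-embI-disjoint : ∀ {n} l l′ m (h : l + m ≤ n) (j : Fin m) → Disjoint l l′ m →
                            inIntervalᵇ l′ m (embI l m h j) ≡ false
inIntervalᵇ-embI-disjoint l l′ m h j disj with inIntervalᵇ l′ m (embI l m h j) in inI′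
... | false = refl
... | true with inIntervalᵇ-bounds l′ m inI′ | disj
...   | l′≤x , _ | inj₁ l+m≤l′ = ⊥-elim (<⇒≱ (<-≤-trans x<l+m l+m≤l′) l′≤x)
  where
  x<l+m : toℕ (embI l m h j) < l + m
  x<l+m = subst (_< l + m) (sym (toℕ-embI l m h j)) (+-monoʳ-< l (Finₚ.toℕ<n j))
...   | _ , x<l′+m | inj₂ l′+m≤l = ⊥-elim (<⇒≱ (<-≤-trans x<l′+m l′+m≤l) l≤x)
  where
  l≤x : l ≤ toℕ (embI l m h j)
  l≤x = subst (l ≤_) (sym (toℕ-embI l m h j)) (m≤m+n l (toℕ j))

module _ (l m : ℕ) .{{_ : NonZero m}} where

  -- The inverse of embI on I, i.e. h_I on coordinates; its values off I are never used.
  unembI : ∀ {n} → Fin n → Fin m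
  unembI x = (toℕ x ∸ l) mod m

  unembPoint : ∀ {n s} {ds : Vec ℕ s} → Point n ds → Point m ds
  unembPoint {ds = d ∷ ds} (inj₁ v) = inj₁ (V.map unembI v)
  unembPoint {ds = d ∷ ds} (inj₂ p) = inj₂ (unembPoint p)

  toℕ-unembI : ∀ {n} (x : Fin n) → toℕ x ∸ l < m → toℕ (unembI x) ≡ toℕ x ∸ l
  toℕ-unembI x x∸l<m = trans (Finₚ.toℕ-fromℕ< _) (m<n⇒m%n≡m x∸l<m)

  unembI-embI : ∀ {n} (h : l + m ≤ n) (j : Fin m) → unembI (embI l m h j) ≡ j
  unembI-embI h j = Finₚ.toℕ-injective (begin
    toℕ (unembI (embI l m h j))  ≡⟨ toℕ-unembI _ (subst (_< m) (sym x∸l≡j) (Finₚ.toℕ<n j)) ⟩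
    toℕ (embI l m h j) ∸ l       ≡⟨ x∸l≡j ⟩
    toℕ j                        ∎)
    where
    open ≡-Reasoning
    x∸l≡j : toℕ (embI l m h j) ∸ l ≡ toℕ j
    x∸l≡j = trans (cong (_∸ l) (toℕ-embI l m h j)) (m+n∸m≡n l (toℕ j))

  embI-unembI : ∀ {n} (h : l + m ≤ n) (x : Fin n) → inIntervalᵇ l m x ≡ true → embI l m h (unembI x) ≡ x
  embI-unembI h x inI with inIntervalᵇ-bounds l m inI
  ... | l≤x , x<l+m = Finₚ.toℕ-injective (begin
    toℕ (embI l m h (unembI x))  ≡⟨ toℕ-embI l m h (unembI x) ⟩
    l + toℕ (unembI x)           ≡⟨ cong (l +_) (toℕ-unembI x (m<n+o⇒m∸n<o (toℕ x) l x<l+m)) ⟩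
    l + (toℕ x ∸ l)              ≡⟨ m+[n∸m]≡n l≤x ⟩
    toℕ x                        ∎)
    where open ≡-Reasoning

  unembPoint-embPoint : ∀ {n s} {ds : Vec ℕ s} (h : l + m ≤ n) (q : Point m ds) →
                        unembPoint (embPoint l m h q) ≡ q
  unembPoint-embPoint {ds = d ∷ ds} h (inj₁ v) = cong inj₁ (begin
    V.map unembI (V.map (embI l m h) v)  ≡⟨ Vecₚ.map-∘ unembI (embI l m h) v ⟨
    V.map (unembI ∘ embI l m h) v        ≡⟨ Vecₚ.map-cong (unembI-embI h) v ⟩
    V.map id v                           ≡⟨ Vecₚ.map-id v ⟩
    v                                    ∎)
    where open ≡-Reasoning
  unembPoint-embPoint {ds = d ∷ ds} h (inj₂ q) = cong inj₂ (unembPoint-embPoint h q)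

  embPoint-unembPoint : ∀ {n s} {ds : Vec ℕ s} (h : l + m ≤ n) (p : Point n ds) → inIᵇ l m p ≡ true →
                        embPoint l m h (unembPoint p) ≡ p
  embPoint-unembPoint {ds = d ∷ ds} h (inj₁ v) inI = cong inj₁ (embed-unembed v inI)
    where
    embed-unembed : ∀ {k} (v : Vec (Fin _) k) → V.foldr _ (λ x b → inIntervalᵇ l m x ∧ b) true v ≡ true →
                    V.map (embI l m h) (V.map unembI v) ≡ v
    embed-unembed []      _   = refl
    embed-unembed (x ∷ v) inI with ∧-true {inIntervalᵇ l m x} inI
    ... | x∈I , v∈I = cong₂ _∷_ (embI-unembI h x x∈I) (embed-unembed v v∈I)
  embPoint-unembPoint {ds = d ∷ ds} h (inj₂ p) inI = cong inj₂ (embPoint-unembPoint h p inI)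

inIᵇ-embPoint : ∀ {n s} {ds : Vec ℕ s} l m (h : l + m ≤ n) (q : Point m ds) → inIᵇ l m (embPoint l m h q) ≡ true
inIᵇ-embPoint {ds = d ∷ ds} l m h (inj₁ v) = all-inside v
  where
  all-inside : ∀ {k} (v : Vec (Fin m) k) →
               V.foldr _ (λ x b → inIntervalᵇ l m x ∧ b) true (V.map (embI l m h) v) ≡ true
  all-inside []      = refl
  all-inside (j ∷ v) = cong₂ _∧_ (inIntervalᵇ-embI l m h j) (all-inside v)
inIᵇ-embPoint {ds = d ∷ ds} l m h (inj₂ q) = inIᵇ-embPoint l m h q

-- The unique point of [m]^0 lies in every I^0, hence the positive dimensions.
inIᵇ-embPoint-disjoint : ∀ {n s} {ds : Vec ℕ s} → All (1 ≤_) ds → ∀ l l′ m (h : l + m ≤ n) (q : Point m ds) →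
                         Disjoint l l′ m → inIᵇ l′ m (embPoint l m h q) ≡ false
inIᵇ-embPoint-disjoint {ds = suc d ∷ ds} (_ ∷ _) l l′ m h (inj₁ (j ∷ v)) disj
  rewrite inIntervalᵇ-embI-disjoint l l′ m h j disj = refl
inIᵇ-embPoint-disjoint {ds = d ∷ ds} (_ ∷ ds-pos) l l′ m h (inj₂ q) disj =
  inIᵇ-embPoint-disjoint ds-pos l l′ m h q disj

-- Arithmetic and densities

1≤m*n⇒1≤n : ∀ m {n} → 1 ≤ m * n → 1 ≤ n
1≤m*n⇒1≤n m {n} 1≤m*n = >-nonZero⁻¹ n {{m*n≢0⇒n≢0 m {{>-nonZero 1≤m*n}}}}

mixture-bound : ∀ {α ρ q s s′} X → s + s′ ≡ q → 1 ≤ s → α + q ≤ ρ → α * s * X + s′ * (suc ρ * X) ≤ ρ * (q * X)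
mixture-bound {α} {ρ} {q} {s} {s′} X s+s′≡q 1≤s α+q≤ρ = begin
  α * s * X + s′ * (suc ρ * X)             ≡⟨ expand α s X s′ ρ ⟩
  α * s * X + s′ * X + ρ * s′ * X          ≤⟨ +-monoˡ-≤ (ρ * s′ * X) (+-monoʳ-≤ (α * s * X) (*-monoˡ-≤ X s′≤q*s)) ⟩
  α * s * X + q * s * X + ρ * s′ * X       ≡⟨ collect α s X q ρ s′ ⟩
  (α + q) * s * X + ρ * s′ * X             ≤⟨ +-monoˡ-≤ (ρ * s′ * X) (*-monoˡ-≤ X (*-monoˡ-≤ s α+q≤ρ)) ⟩
  ρ * s * X + ρ * s′ * X                   ≡⟨ factor ρ s X s′ ⟩
  ρ * ((s + s′) * X)                       ≡⟨ cong (λ t → ρ * (t * X)) s+s′≡q ⟩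
  ρ * (q * X)                              ∎
  where
  open ≤-Reasoning
  s′≤q*s : s′ ≤ q * s
  s′≤q*s = ≤-trans (m≤n+m s′ s) (≤-trans (≤-reflexive s+s′≡q) (m≤m*n q s {{>-nonZero 1≤s}}))
  expand : ∀ α s X s′ ρ → α * s * X + s′ * (suc ρ * X) ≡ α * s * X + s′ * X + ρ * s′ * X
  expand = solve-∀
  collect : ∀ α s X q ρ s′ → α * s * X + q * s * X + ρ * s′ * X ≡ (α + q) * s * X + ρ * s′ * X
  collect = solve-∀
  factor : ∀ ρ s X s′ → ρ * s * X + ρ * s′ * X ≡ ρ * ((s + s′) * X)
  factor = solve-∀

scale-≤ : ∀ {x G Y y} k → x * G ≤ Y * y → x * k * G ≤ Y * (y * k)
scale-≤ {x} {G} {Y} {y} k le = subst₂ _≤_ (rearrangeˡ k x G) (rearrangeʳ k Y y) (*-monoʳ-≤ k le)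
  where
  rearrangeˡ : ∀ k x G → k * (x * G) ≡ x * k * G
  rearrangeˡ = solve-∀
  rearrangeʳ : ∀ k Y y → k * (Y * y) ≡ Y * (y * k)
  rearrangeʳ = solve-∀

DensityAtLeast : ∀ {n s} {ds : Vec ℕ s} → ℕ → ℕ → Family n ds → Family n ds → Set
DensityAtLeast ρ D 𝒜 F = ρ * card F ≤ D * card (𝒜 ∩F F)

card-∩-≤ : ∀ {n s} {ds : Vec ℕ s} (𝒜 F : Family n ds) → card (𝒜 ∩F F) ≤ card F
card-∩-≤ {n} {ds = ds} 𝒜 F = subst₂ _≤_ (sym (card≡∑ (𝒜 ∩F F))) (sym (card≡∑ F)) (∑-mono (allConfigs n ds) (λ x → ⟦∧⟧≤ (𝒜 x) (F x)))
  where
  ⟦∧⟧≤ : ∀ a b → ⟦ a ∧ b ⟧ ≤ ⟦ b ⟧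
  ⟦∧⟧≤ true  b = ≤-refl
  ⟦∧⟧≤ false b = z≤n

density≤1 : ∀ {n s} {ds : Vec ℕ s} {ρ D} (𝒜 F : Family n ds) → 1 ≤ card F → DensityAtLeast ρ D 𝒜 F → ρ ≤ D
density≤1 {D = D} 𝒜 F 1≤|F| dense = *-cancelʳ-≤ _ D (card F) {{>-nonZero 1≤|F|}} (≤-trans dense (*-monoʳ-≤ D (card-∩-≤ 𝒜 F)))

-- Splitting configurations at an interval

nPatterns : ∀ {s} → ℕ → Vec ℕ s → ℕ
nPatterns m ds = 2 ^ groundSize m ds

AvoidsInterval : ∀ {n s} {ds : Vec ℕ s} (l m : ℕ) → Config n ds → Set
AvoidsInterval {n} {ds = ds} l m U = (p : Point n ds) → T (inIᵇ l m p) → mem U p ≡ false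

module Interval {n s} {ds : Vec ℕ s} (m : ℕ) .{{_ : NonZero m}} (l : ℕ) (h : l + m ≤ n) where

  configs : List (Config n ds)
  configs = allConfigs n ds

  patterns : List (Config m ds)
  patterns = allConfigs m ds

  glue : Config m ds → Config n ds → Config n ds
  glue P U = tab (λ p → if inIᵇ l m p then mem P (unembPoint l m p) else mem U p)

  outsideᵇ : Config n ds → Bool
  outsideᵇ U = eqConfig (outsideI l m U) U

  mem-glue : ∀ P U p → mem (glue P U) p ≡ (if inIᵇ l m p then mem P (unembPoint l m p) else mem U p)
  mem-glue P U = mem-tab (λ p → if inIᵇ l m p then mem P (unembPoint l m p) else mem U p)

  mem-outsideI : ∀ (x : Config n ds) p → mem (outsideI l m x) p ≡ mem x p ∧ not (inIᵇ l m p)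
  mem-outsideI x = mem-tab (λ p → mem x p ∧ not (inIᵇ l m p))

  mem-hI : ∀ (x : Config n ds) q → mem (hI l m h x) q ≡ mem x (embPoint l m h q)
  mem-hI x = mem-tab (λ q → mem x (embPoint l m h q))

  outsideᵇ-sound : ∀ {U} → outsideᵇ U ≡ true → outsideI l m U ≡ U
  outsideᵇ-sound = eqConfig-sound

  outsideᵇ⇒avoids : ∀ {U} → outsideᵇ U ≡ true → AvoidsInterval l m U
  outsideᵇ⇒avoids {U} out p p∈I = begin
    mem U p                         ≡⟨ cong (λ V → mem V p) (outsideᵇ-sound out) ⟨
    mem (outsideI l m U) p          ≡⟨ mem-outsideI U p ⟩
    mem U p ∧ not (inIᵇ l m p)      ≡⟨ cong (λ b → mem U p ∧ not b) (Boolₚ.T-≡ .to p∈I) ⟩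
    mem U p ∧ false                 ≡⟨ Boolₚ.∧-zeroʳ (mem U p) ⟩
    false                           ∎
    where open ≡-Reasoning

  avoids⇒outsideᵇ : ∀ {U} → AvoidsInterval l m U → outsideᵇ U ≡ true
  avoids⇒outsideᵇ {U} avoids = eqConfig-complete (Config-ext _ U (λ p →
    trans (mem-outsideI U p) (off-interval p (inIᵇ l m p) refl)))
    where
    off-interval : ∀ p b → inIᵇ l m p ≡ b → mem U p ∧ not b ≡ mem U p
    off-interval p true  p∈I = trans (Boolₚ.∧-zeroʳ (mem U p)) (sym (avoids p (Boolₚ.T-≡ .from p∈I)))
    off-interval p false _   = Boolₚ.∧-identityʳ (mem U p)

  hI-glue : ∀ P (U : Config n ds) → hI l m h (glue P U) ≡ P
  hI-glue P U = Config-ext _ P (λ q → begin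
    mem (hI l m h (glue P U)) q        ≡⟨ mem-hI (glue P U) q ⟩
    mem (glue P U) (embPoint l m h q)  ≡⟨ mem-glue P U _ ⟩
    (if inIᵇ l m (embPoint l m h q) then mem P (unembPoint l m (embPoint l m h q)) else mem U (embPoint l m h q))
      ≡⟨ cong (λ b → if b then mem P (unembPoint l m (embPoint l m h q)) else mem U (embPoint l m h q)) (inIᵇ-embPoint l m h q) ⟩
    mem P (unembPoint l m (embPoint l m h q))  ≡⟨ cong (mem P) (unembPoint-embPoint l m h q) ⟩
    mem P q                            ∎)
    where open ≡-Reasoning

  outsideI-glue : ∀ P {U} → outsideᵇ U ≡ true → outsideI l m (glue P U) ≡ U
  outsideI-glue P {U} out = Config-ext _ U (λ p →
    trans (mem-outsideI _ p) (trans (cong (_∧ not (inIᵇ l m p)) (mem-glue P U p)) (off-interval p (inIᵇ l m p) refl)))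
    where
    off-interval : ∀ p b → inIᵇ l m p ≡ b → (if b then mem P (unembPoint l m p) else mem U p) ∧ not b ≡ mem U p
    off-interval p true  p∈I = trans (Boolₚ.∧-zeroʳ _) (sym (outsideᵇ⇒avoids out p (Boolₚ.T-≡ .from p∈I)))
    off-interval p false _   = Boolₚ.∧-identityʳ (mem U p)

  glue-hI-outsideI : ∀ (x : Config n ds) → glue (hI l m h x) (outsideI l m x) ≡ x
  glue-hI-outsideI x = Config-ext _ x (λ p → trans (mem-glue _ _ p) (by-position p (inIᵇ l m p) refl))
    where
    by-position : ∀ p b → inIᵇ l m p ≡ b →
                  (if b then mem (hI l m h x) (unembPoint l m p) else mem (outsideI l m x) p) ≡ mem x p
    by-position p true  p∈I = trans (mem-hI x _) (cong (mem x) (embPoint-unembPoint l m h p p∈I))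
    by-position p false p∉I = trans (mem-outsideI x p) (trans (cong (λ b → mem x p ∧ not b) p∉I) (Boolₚ.∧-identityʳ _))

  outsideᵇ-outsideI : ∀ (x : Config n ds) → outsideᵇ (outsideI l m x) ≡ true
  outsideᵇ-outsideI x = eqConfig-complete (Config-ext _ _ (λ p → begin
    mem (outsideI l m (outsideI l m x)) p                ≡⟨ mem-outsideI _ p ⟩
    mem (outsideI l m x) p ∧ not (inIᵇ l m p)            ≡⟨ cong (_∧ not (inIᵇ l m p)) (mem-outsideI x p) ⟩
    (mem x p ∧ not (inIᵇ l m p)) ∧ not (inIᵇ l m p)      ≡⟨ Boolₚ.∧-assoc (mem x p) _ _ ⟩
    mem x p ∧ (not (inIᵇ l m p) ∧ not (inIᵇ l m p))      ≡⟨ cong (mem x p ∧_) (Boolₚ.∧-idem _) ⟩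
    mem x p ∧ not (inIᵇ l m p)                           ≡⟨ mem-outsideI x p ⟨
    mem (outsideI l m x) p                               ∎))
    where open ≡-Reasoning

  eqConfig-glue : ∀ (x : Config n ds) P {U} → outsideᵇ U ≡ true →
                  eqConfig x (glue P U) ≡ eqConfig (hI l m h x) P ∧ eqConfig (outsideI l m x) U
  eqConfig-glue x P {U} out = bool-ext
    (λ x==PU → subst (λ y → eqConfig (hI l m h y) P ∧ eqConfig (outsideI l m y) U ≡ true) (sym (eqConfig-sound x==PU))
                     (cong₂ _∧_ (eqConfig-complete (hI-glue P U)) (eqConfig-complete (outsideI-glue P out))))
    (λ parts → let (hx==P , ox==U) = ∧-true {eqConfig (hI l m h x) P} parts in
      eqConfig-complete (trans (sym (glue-hI-outsideI x)) (cong₂ glue (eqConfig-sound hx==P) (eqConfig-sound ox==U))))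

  -- x ↦ (hI x , outsideI x) is a bijection onto patterns × configurations avoiding I, inverse to glue.
  ∑-glue : (f : Config n ds → ℕ) → ∑[ x ∈ configs ] f x ≡ ∑[ U ∈ configs ] (⟦ outsideᵇ U ⟧ * ∑[ P ∈ patterns ] f (glue P U))
  ∑-glue = ∑-fibres configs patterns (λ U → ⟦ outsideᵇ U ⟧) (λ U P → glue P U) one-fibre
    where
    fibre : ∀ x U → ⟦ outsideᵇ U ⟧ * ∑[ P ∈ patterns ] ⟦ eqConfig x (glue P U) ⟧ ≡ ⟦ eqConfig (outsideI l m x) U ⟧
    fibre x U with outsideᵇ U in out
    ... | true = begin
      ∑[ P ∈ patterns ] ⟦ eqConfig x (glue P U) ⟧ + 0
        ≡⟨ +-identityʳ _ ⟩
      ∑[ P ∈ patterns ] ⟦ eqConfig x (glue P U) ⟧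
        ≡⟨ ∑-cong patterns (λ P → trans (cong ⟦_⟧ (eqConfig-glue x P out)) (⟦∧⟧ (eqConfig (hI l m h x) P) _)) ⟩
      ∑[ P ∈ patterns ] (⟦ eqConfig (hI l m h x) P ⟧ * ⟦ eqConfig (outsideI l m x) U ⟧)
        ≡⟨ ∑-*ʳ _ patterns (λ P → ⟦ eqConfig (hI l m h x) P ⟧) ⟩
      ∑[ P ∈ patterns ] ⟦ eqConfig (hI l m h x) P ⟧ * ⟦ eqConfig (outsideI l m x) U ⟧
        ≡⟨ cong (_* ⟦ eqConfig (outsideI l m x) U ⟧) (allConfigs-enumerates m ds (hI l m h x)) ⟩
      1 * ⟦ eqConfig (outsideI l m x) U ⟧
        ≡⟨ *-identityˡ _ ⟩
      ⟦ eqConfig (outsideI l m x) U ⟧ ∎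
      where open ≡-Reasoning
    ... | false with eqConfig (outsideI l m x) U in ox==U
    ...   | false = refl
    ...   | true  = contradiction (begin
      true                          ≡⟨ outsideᵇ-outsideI x ⟨
      outsideᵇ (outsideI l m x)     ≡⟨ cong outsideᵇ (eqConfig-sound ox==U) ⟩
      outsideᵇ U                    ≡⟨ out ⟩
      false                         ∎) (λ ())
      where open ≡-Reasoning
    one-fibre : ∀ x → ∑[ U ∈ configs ] (⟦ outsideᵇ U ⟧ * ∑[ P ∈ patterns ] ⟦ eqConfig x (glue P U) ⟧) ≡ 1
    one-fibre x = trans (∑-cong configs (fibre x)) (allConfigs-enumerates n ds (outsideI l m x))

  Independent : Family n ds → Set
  Independent F = ∀ P {U} → outsideᵇ U ≡ true → F (glue P U) ≡ F U

  weight : Family n ds → Config n ds → ℕ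
  weight F U = ⟦ outsideᵇ U ∧ F U ⟧

  card-∩-independent : (Φ F : Family n ds) → Independent F →
                       card (Φ ∩F F) ≡ ∑[ P ∈ patterns ] ∑[ U ∈ configs ] (weight F U * ⟦ Φ (glue P U) ⟧)
  card-∩-independent Φ F F-indep = begin
    card (Φ ∩F F)
      ≡⟨ card≡∑ (Φ ∩F F) ⟩
    ∑[ x ∈ configs ] ⟦ Φ x ∧ F x ⟧
      ≡⟨ ∑-glue (λ x → ⟦ Φ x ∧ F x ⟧) ⟩
    ∑[ U ∈ configs ] (⟦ outsideᵇ U ⟧ * ∑[ P ∈ patterns ] ⟦ Φ (glue P U) ∧ F (glue P U) ⟧)
      ≡⟨ ∑-cong configs per-outside ⟩
    ∑[ U ∈ configs ] ∑[ P ∈ patterns ] (weight F U * ⟦ Φ (glue P U) ⟧)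
      ≡⟨ ∑-comm configs patterns _ ⟩
    ∑[ P ∈ patterns ] ∑[ U ∈ configs ] (weight F U * ⟦ Φ (glue P U) ⟧) ∎
    where
    open ≡-Reasoning
    per-outside : ∀ U → ⟦ outsideᵇ U ⟧ * ∑[ P ∈ patterns ] ⟦ Φ (glue P U) ∧ F (glue P U) ⟧ ≡
                        ∑[ P ∈ patterns ] (weight F U * ⟦ Φ (glue P U) ⟧)
    per-outside U with outsideᵇ U in out
    ... | false = sym (∑-zero patterns)
    ... | true  = trans (+-identityʳ _) (∑-cong patterns (λ P → begin
      ⟦ Φ (glue P U) ∧ F (glue P U) ⟧  ≡⟨ cong (λ b → ⟦ Φ (glue P U) ∧ b ⟧) (F-indep P out) ⟩
      ⟦ Φ (glue P U) ∧ F U ⟧           ≡⟨ ⟦∧⟧ (Φ (glue P U)) (F U) ⟩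
      ⟦ Φ (glue P U) ⟧ * ⟦ F U ⟧        ≡⟨ *-comm ⟦ Φ (glue P U) ⟧ ⟦ F U ⟧ ⟩
      ⟦ F U ⟧ * ⟦ Φ (glue P U) ⟧        ∎))

  nOutside : Family n ds → ℕ
  nOutside F = ∑[ U ∈ configs ] weight F U

  hitsOutside : Family n ds → Family n ds → Config m ds → ℕ
  hitsOutside 𝒜 F P = ∑[ U ∈ configs ] (weight F U * ⟦ 𝒜 (glue P U) ⟧)

  hitsInside : Family m ds → Family n ds → Config n ds → ℕ
  hitsInside S 𝒜 U = ∑[ P ∈ patterns ] (⟦ S P ⟧ * ⟦ 𝒜 (glue P U) ⟧)

  slice : Config m ds → Family n ds → Family n ds
  slice c F = (λ x → eqConfig (hI l m h x) c) ∩F F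

  card-independent : (F : Family n ds) → Independent F → card F ≡ nPatterns m ds * nOutside F
  card-independent F F-indep = begin
    card F                                                          ≡⟨ card-∩-independent (λ _ → true) F F-indep ⟩
    ∑[ P ∈ patterns ] ∑[ U ∈ configs ] (weight F U * 1)             ≡⟨ ∑-cong patterns (λ _ → ∑-*ʳ 1 configs (weight F)) ⟩
    ∑[ P ∈ patterns ] (nOutside F * 1)                              ≡⟨ ∑-cong patterns (λ _ → *-comm (nOutside F) 1) ⟩
    ∑[ P ∈ patterns ] (1 * nOutside F)                              ≡⟨ ∑-*ʳ (nOutside F) patterns (λ _ → 1) ⟩
    ∑[ P ∈ patterns ] 1 * nOutside F                                ≡⟨ cong (_* nOutside F) (size-allConfigs m ds) ⟩
    nPatterns m ds * nOutside F                                     ∎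
    where open ≡-Reasoning

  1≤nOutside : (F : Family n ds) → Independent F → 1 ≤ card F → 1 ≤ nOutside F
  1≤nOutside F F-indep 1≤|F| = 1≤m*n⇒1≤n (nPatterns m ds) (subst (1 ≤_) (card-independent F F-indep) 1≤|F|)

  eqConfig-hI-glue : ∀ P U c → eqConfig (hI l m h (glue P U)) c ≡ eqConfig c P
  eqConfig-hI-glue P U c = trans (cong (λ Q → eqConfig Q c) (hI-glue P U)) (eqConfig-sym P c)

  card-slice : ∀ c (F : Family n ds) → Independent F → card (slice c F) ≡ nOutside F
  card-slice c F F-indep = begin
    card (slice c F)
      ≡⟨ card-∩-independent _ F F-indep ⟩
    ∑[ P ∈ patterns ] ∑[ U ∈ configs ] (weight F U * ⟦ eqConfig (hI l m h (glue P U)) c ⟧)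
      ≡⟨ ∑-cong patterns (λ P → trans (∑-cong configs (λ U → cong (λ b → weight F U * ⟦ b ⟧) (eqConfig-hI-glue P U c)))
                                      (∑-*ʳ _ configs (weight F))) ⟩
    ∑[ P ∈ patterns ] (nOutside F * ⟦ eqConfig c P ⟧)
      ≡⟨ ∑-cong patterns (λ P → *-comm (nOutside F) _) ⟩
    ∑[ P ∈ patterns ] (⟦ eqConfig c P ⟧ * nOutside F)
      ≡⟨ ∑-allConfigs-eq m ds c (λ _ → nOutside F) ⟩
    nOutside F ∎
    where open ≡-Reasoning

  card-∩-slice : ∀ (𝒜 : Family n ds) c (F : Family n ds) → Independent F → card (𝒜 ∩F slice c F) ≡ hitsOutside 𝒜 F c
  card-∩-slice 𝒜 c F F-indep = begin
    card (𝒜 ∩F slice c F)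
      ≡⟨ card-cong (λ x → sym (Boolₚ.∧-assoc (𝒜 x) _ (F x))) ⟩
    card ((λ x → 𝒜 x ∧ eqConfig (hI l m h x) c) ∩F F)
      ≡⟨ card-∩-independent _ F F-indep ⟩
    ∑[ P ∈ patterns ] ∑[ U ∈ configs ] (weight F U * ⟦ 𝒜 (glue P U) ∧ eqConfig (hI l m h (glue P U)) c ⟧)
      ≡⟨ ∑-cong patterns (λ P → trans (∑-cong configs (λ U → at-c P U)) (∑-*ˡ ⟦ eqConfig c P ⟧ configs _)) ⟩
    ∑[ P ∈ patterns ] (⟦ eqConfig c P ⟧ * hitsOutside 𝒜 F P)
      ≡⟨ ∑-allConfigs-eq m ds c (hitsOutside 𝒜 F) ⟩
    hitsOutside 𝒜 F c ∎
    where
    open ≡-Reasoning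
    at-c : ∀ P U → weight F U * ⟦ 𝒜 (glue P U) ∧ eqConfig (hI l m h (glue P U)) c ⟧ ≡
                   ⟦ eqConfig c P ⟧ * (weight F U * ⟦ 𝒜 (glue P U) ⟧)
    at-c P U rewrite eqConfig-hI-glue P U c | ⟦∧⟧ (𝒜 (glue P U)) (eqConfig c P) =
      x∙yz≈z∙xy (weight F U) ⟦ 𝒜 (glue P U) ⟧ ⟦ eqConfig c P ⟧

  weight-𝒞 : ∀ {U₀} → outsideᵇ U₀ ≡ true → ∀ U → weight (λ x → eqConfig (outsideI l m x) U₀) U ≡ ⟦ eqConfig U₀ U ⟧
  weight-𝒞 {U₀} out₀ U with outsideᵇ U in out
  ... | true = cong ⟦_⟧ (trans (cong (λ V → eqConfig V U₀) (outsideᵇ-sound out)) (eqConfig-sym U U₀))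
  ... | false with eqConfig U₀ U in U₀==U
  ...   | false = refl
  ...   | true  = contradiction (trans (sym out₀) (trans (cong outsideᵇ (eqConfig-sound U₀==U)) out)) (λ ())

  -- 𝒞(I,U₀) is (S ∘ h_I) ∩ {x ∣ outsideI x = U₀}, and the second factor is independent of I.
  card-∩𝒞 : ∀ (S : Family m ds) (𝒜 : Family n ds) {U₀} → outsideᵇ U₀ ≡ true →
            card (𝒜 ∩F 𝒞 m S l h U₀) ≡ hitsInside S 𝒜 U₀
  card-∩𝒞 S 𝒜 {U₀} out₀ = begin
    card (𝒜 ∩F 𝒞 m S l h U₀)
      ≡⟨ card-cong (λ x → sym (Boolₚ.∧-assoc (𝒜 x) _ _)) ⟩
    card ((λ x → 𝒜 x ∧ S (hI l m h x)) ∩F G)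
      ≡⟨ card-∩-independent _ G G-indep ⟩
    ∑[ P ∈ patterns ] ∑[ U ∈ configs ] (weight G U * ⟦ 𝒜 (glue P U) ∧ S (hI l m h (glue P U)) ⟧)
      ≡⟨ ∑-cong patterns (λ P → trans (∑-cong configs (λ U → cong (_* _) (weight-𝒞 out₀ U)))
                                      (∑-allConfigs-eq n ds U₀ _)) ⟩
    ∑[ P ∈ patterns ] ⟦ 𝒜 (glue P U₀) ∧ S (hI l m h (glue P U₀)) ⟧
      ≡⟨ ∑-cong patterns (λ P → trans (cong (λ Q → ⟦ 𝒜 (glue P U₀) ∧ S Q ⟧) (hI-glue P U₀))
                                      (trans (⟦∧⟧ (𝒜 (glue P U₀)) (S P)) (*-comm ⟦ 𝒜 (glue P U₀) ⟧ ⟦ S P ⟧))) ⟩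
    ∑[ P ∈ patterns ] (⟦ S P ⟧ * ⟦ 𝒜 (glue P U₀) ⟧) ∎
    where
    open ≡-Reasoning
    G : Family n ds
    G x = eqConfig (outsideI l m x) U₀
    G-indep : Independent G
    G-indep P out = cong (λ V → eqConfig V U₀) (trans (outsideI-glue P out) (sym (outsideᵇ-sound out)))

  card-𝒞 : ∀ (S : Family m ds) {U₀} → AvoidsInterval l m U₀ → card (𝒞 m S l h U₀) ≡ card S
  card-𝒞 S avoids = begin
    card (𝒞 m S l h _)                      ≡⟨ card-∩𝒞 S (λ _ → true) (avoids⇒outsideᵇ avoids) ⟩
    ∑[ P ∈ patterns ] (⟦ S P ⟧ * 1)         ≡⟨ ∑-cong patterns (λ P → *-identityʳ ⟦ S P ⟧) ⟩
    ∑[ P ∈ patterns ] ⟦ S P ⟧               ≡⟨ card≡∑ S ⟨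
    card S                                  ∎
    where open ≡-Reasoning

  ∑-hitsInside≡∑-hitsOutside : ∀ (S : Family m ds) (𝒜 F : Family n ds) →
                  ∑[ U ∈ configs ] (weight F U * hitsInside S 𝒜 U) ≡
                  ∑[ P ∈ patterns ] (⟦ S P ⟧ * hitsOutside 𝒜 F P)
  ∑-hitsInside≡∑-hitsOutside S 𝒜 F = begin
    ∑[ U ∈ configs ] (weight F U * ∑[ P ∈ patterns ] (⟦ S P ⟧ * ⟦ 𝒜 (glue P U) ⟧))
      ≡⟨ ∑-cong configs (λ U → sym (∑-*ˡ (weight F U) patterns _)) ⟩
    ∑[ U ∈ configs ] ∑[ P ∈ patterns ] (weight F U * (⟦ S P ⟧ * ⟦ 𝒜 (glue P U) ⟧))
      ≡⟨ ∑-comm configs patterns _ ⟩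
    ∑[ P ∈ patterns ] ∑[ U ∈ configs ] (weight F U * (⟦ S P ⟧ * ⟦ 𝒜 (glue P U) ⟧))
      ≡⟨ ∑-cong patterns (λ P → trans (∑-cong configs (λ U → x∙yz≈y∙xz (weight F U) ⟦ S P ⟧ ⟦ 𝒜 (glue P U) ⟧))
                                      (∑-*ˡ ⟦ S P ⟧ configs _)) ⟩
    ∑[ P ∈ patterns ] (⟦ S P ⟧ * hitsOutside 𝒜 F P) ∎
    where
    open ≡-Reasoning

-- The density increment

hI-glue-disjoint : ∀ {n s} {ds : Vec ℕ s} → All (1 ≤_) ds → ∀ m .{{_ : NonZero m}} l l′ (h : l + m ≤ n) (h′ : l′ + m ≤ n) →
                   Disjoint l l′ m → ∀ P U → hI l m h (Interval.glue {ds = ds} m l′ h′ P U) ≡ hI l m h U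
hI-glue-disjoint ds-pos m l l′ h h′ disj P U = Config-ext _ _ (λ q → begin
  mem (hI l m h (glue P U)) q          ≡⟨ mem-tab _ q ⟩
  mem (glue P U) (embPoint l m h q)    ≡⟨ mem-glue P U _ ⟩
  (if inIᵇ l′ m (embPoint l m h q) then mem P (unembPoint l′ m (embPoint l m h q)) else mem U (embPoint l m h q))
    ≡⟨ cong (λ b → if b then mem P (unembPoint l′ m (embPoint l m h q)) else mem U (embPoint l m h q))
            (inIᵇ-embPoint-disjoint ds-pos l l′ m h q disj) ⟩
  mem U (embPoint l m h q)             ≡⟨ mem-tab _ q ⟨
  mem (hI l m h U) q                   ∎)
  where
  open ≡-Reasoning
  open Interval m l′ h′ using (glue; mem-glue)

slice-independent : ∀ {n s} {ds : Vec ℕ s} → All (1 ≤_) ds → ∀ m .{{_ : NonZero m}} l l′ (h : l + m ≤ n) (h′ : l′ + m ≤ n) →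
                    Disjoint l l′ m → ∀ c {F : Family n ds} → Interval.Independent m l′ h′ F →
                    Interval.Independent m l′ h′ (Interval.slice m l h c F)
slice-independent ds-pos m l l′ h h′ disj c F-indep P out =
  cong₂ _∧_ (cong (λ Q → eqConfig Q c) (hI-glue-disjoint ds-pos m l l′ h h′ disj P _)) (F-indep P out)

module Step {n s} {ds : Vec ℕ s} (m : ℕ) .{{_ : NonZero m}} (l : ℕ) (h : l + m ≤ n)
            (S : Family m ds) (𝒜 F : Family n ds) (F-indep : Interval.Independent m l h F) (α ρ D : ℕ) where
  open Interval {ds = ds} m l h

  s′ hits-in-S hits-off-S : ℕ
  s′         = ∑[ P ∈ patterns ] ⟦ not (S P) ⟧
  hits-in-S  = ∑[ P ∈ patterns ] (⟦ S P ⟧ * hitsOutside 𝒜 F P)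
  hits-off-S = ∑[ P ∈ patterns ] (⟦ not (S P) ⟧ * hitsOutside 𝒜 F P)

  card+s′≡nPatterns : card S + s′ ≡ nPatterns m ds
  card+s′≡nPatterns = begin
    card S + s′                                                 ≡⟨ cong (_+ s′) (card≡∑ S) ⟩
    ∑[ P ∈ patterns ] ⟦ S P ⟧ + s′                              ≡⟨ ∑-distrib-+ patterns _ _ ⟨
    ∑[ P ∈ patterns ] (⟦ S P ⟧ + ⟦ not (S P) ⟧)                ≡⟨ ∑-cong patterns (λ P → ⟦⟧+⟦not⟧ (S P)) ⟩
    ∑[ P ∈ patterns ] 1                                        ≡⟨ size-allConfigs m ds ⟩
    nPatterns m ds                                             ∎
    where open ≡-Reasoning

  hitsInside-< : ∀ {U} → ¬ (outsideᵇ U ≡ true × DensityAtLeast α D 𝒜 (𝒞 m S l h U)) →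
                 outsideᵇ U ∧ F U ≡ true → D * hitsInside S 𝒜 U < α * card S
  hitsInside-< not-dense out∧FU with ∧-true out∧FU
  ... | out , _ = subst₂ _<_ (cong (D *_) (card-∩𝒞 S 𝒜 out)) (cong (α *_) (card-𝒞 S (outsideᵇ⇒avoids out)))
                         (≰⇒> (λ le → not-dense (out , le)))

  hitsOutside-< : ∀ {c} → ¬ DensityAtLeast (suc ρ) D 𝒜 (slice c F) → D * hitsOutside 𝒜 F c < suc ρ * nOutside F
  hitsOutside-< {c} not-dense =
    subst₂ _<_ (cong (D *_) (card-∩-slice 𝒜 c F F-indep)) (cong (suc ρ *_) (card-slice c F F-indep)) (≰⇒> not-dense)

  hits-in-S-bound : ListAll.All (λ U → outsideᵇ U ∧ F U ≡ true → D * hitsInside S 𝒜 U < α * card S) configs →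
                    D * hits-in-S + nOutside F ≤ α * card S * nOutside F
  hits-in-S-bound small = begin
    D * hits-in-S + nOutside F
      ≡⟨ cong (λ t → D * t + nOutside F) (∑-hitsInside≡∑-hitsOutside S 𝒜 F) ⟨
    D * ∑[ U ∈ configs ] (weight F U * hitsInside S 𝒜 U) + nOutside F
      ≡⟨ cong (_+ nOutside F) (trans (sym (∑-*ˡ D configs _)) (∑-cong configs (λ U → x∙yz≈y∙xz D (weight F U) _))) ⟩
    ∑[ U ∈ configs ] (weight F U * (D * hitsInside S 𝒜 U)) + nOutside F
      ≤⟨ ∑-weighted-< configs (λ U → outsideᵇ U ∧ F U) _ (λ _ → α * card S) small ⟩
    ∑[ U ∈ configs ] (weight F U * (α * card S))
      ≡⟨ ∑-*ʳ (α * card S) configs (weight F) ⟩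
    nOutside F * (α * card S)
      ≡⟨ *-comm (nOutside F) (α * card S) ⟩
    α * card S * nOutside F ∎
    where open ≤-Reasoning

  hits-off-S-bound : ListAll.All (λ c → D * hitsOutside 𝒜 F c < suc ρ * nOutside F) patterns →
                     D * hits-off-S + s′ ≤ s′ * (suc ρ * nOutside F)
  hits-off-S-bound small = begin
    D * hits-off-S + s′
      ≡⟨ cong (_+ s′) (trans (sym (∑-*ˡ D patterns _)) (∑-cong patterns (λ P → x∙yz≈y∙xz D ⟦ not (S P) ⟧ _))) ⟩
    ∑[ P ∈ patterns ] (⟦ not (S P) ⟧ * (D * hitsOutside 𝒜 F P)) + s′
      ≤⟨ ∑-weighted-< patterns (λ P → not (S P)) _ (λ _ → suc ρ * nOutside F) (ListAll.map (λ lt _ → lt) small) ⟩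
    ∑[ P ∈ patterns ] (⟦ not (S P) ⟧ * (suc ρ * nOutside F))
      ≡⟨ ∑-*ʳ _ patterns (λ P → ⟦ not (S P) ⟧) ⟩
    s′ * (suc ρ * nOutside F) ∎
    where open ≤-Reasoning

  density-increment-step : 1 ≤ card S → α + nPatterns m ds ≤ ρ → 1 ≤ card F → DensityAtLeast ρ D 𝒜 F →
    (Σ (Config n ds) λ U → AvoidsInterval l m U × DensityAtLeast α D 𝒜 (𝒞 m S l h U)) ⊎
    (Σ (Config m ds) λ c → DensityAtLeast (suc ρ) D 𝒜 (slice c F))
  density-increment-step 1≤|S| α+q≤ρ 1≤|F| dense
    with any? (λ U → (outsideᵇ U Boolₚ.≟ true) ×-dec (α * card (𝒞 m S l h U) ≤? D * card (𝒜 ∩F 𝒞 m S l h U))) configs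
       | any? (λ c → suc ρ * card (slice c F) ≤? D * card (𝒜 ∩F slice c F)) patterns
  ... | yes dense-𝒞 | _ = let (U , out , U-dense) = satisfied dense-𝒞 in inj₁ (U , outsideᵇ⇒avoids out , U-dense)
  ... | no _ | yes dense-slice = inj₂ (satisfied dense-slice)
  ... | no no-dense-𝒞 | no no-dense-slice = contradiction overshoot (<⇒≱ (m<m+n (ρ * (nPatterns m ds * X)) 0<X+s′))
    where
    X = nOutside F
    0<X+s′ : 0 < X + s′
    0<X+s′ = ≤-trans (1≤nOutside F F-indep 1≤|F|) (m≤m+n X s′)
    overshoot : ρ * (nPatterns m ds * X) + (X + s′) ≤ ρ * (nPatterns m ds * X)
    overshoot = begin
      ρ * (nPatterns m ds * X) + (X + s′)
        ≡⟨ cong (λ t → ρ * t + (X + s′)) (card-independent F F-indep) ⟨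
      ρ * card F + (X + s′)
        ≤⟨ +-monoˡ-≤ (X + s′) dense ⟩
      D * card (𝒜 ∩F F) + (X + s′)
        ≡⟨ cong (λ t → D * t + (X + s′)) (trans (card-∩-independent 𝒜 F F-indep) (∑-partition patterns S (hitsOutside 𝒜 F))) ⟩
      D * (hits-in-S + hits-off-S) + (X + s′)
        ≡⟨ trans (cong (_+ (X + s′)) (*-distribˡ-+ D hits-in-S hits-off-S)) (+-interchange (D * hits-in-S) _ X s′) ⟩
      (D * hits-in-S + X) + (D * hits-off-S + s′)
        ≤⟨ +-mono-≤ (hits-in-S-bound (ListAll.map hitsInside-< (¬Any⇒All¬ configs no-dense-𝒞)))
                    (hits-off-S-bound (ListAll.map hitsOutside-< (¬Any⇒All¬ patterns no-dense-slice))) ⟩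
      α * card S * X + s′ * (suc ρ * X)
        ≤⟨ mixture-bound X card+s′≡nPatterns 1≤|S| α+q≤ρ ⟩
      ρ * (nPatterns m ds * X) ∎
      where open ≤-Reasoning

Located : ∀ {n s} (ds : Vec ℕ s) (m : ℕ) → (∀ l → l + m ≤ n → Config n ds → Set) → Set
Located {n} ds m P = Σ ℕ λ l → Σ (l + m ≤ n) λ h → Σ (Config n ds) λ U → AvoidsInterval l m U × P l h U

Located-map : ∀ {n s} {ds : Vec ℕ s} {m} {P Q : ∀ l → l + m ≤ n → Config n ds → Set} →
              (∀ {l h U} → AvoidsInterval l m U → P l h U → Q l h U) → Located ds m P → Located ds m Q
Located-map P⇒Q (l , h , U , avoids , PlhU) = l , h , U , avoids , P⇒Q avoids PlhU

module Iteration {n s} {ds : Vec ℕ s} (ds-pos : All (1 ≤_) ds) (m : ℕ) .{{_ : NonZero m}}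
                 (S : Family m ds) (𝒜 : Family n ds) (α D : ℕ) (1≤|S| : 1 ≤ card S) where

  DenseCollection : Set
  DenseCollection = Located ds m (λ l h U → DensityAtLeast α D 𝒜 (𝒞 m S l h U))

  IndependentFrom : ℕ → Family n ds → Set
  IndependentFrom j F = ∀ i → j ≤ i → (h : i * m + m ≤ n) → Interval.Independent m (i * m) h F

  slice-independentFrom : ∀ {j} (h : j * m + m ≤ n) c {F} → IndependentFrom j F → IndependentFrom (suc j) (Interval.slice m (j * m) h c F)
  slice-independentFrom {j} h c F-indep i j<i h′ =
    slice-independent ds-pos m (j * m) (i * m) h h′ (inj₁ (subst (_≤ i * m) (+-comm m (j * m)) (*-monoˡ-≤ m j<i))) c
                      (F-indep i (<⇒≤ j<i) h′)

  fits-head : ∀ {j r} → j * m + suc r * m ≤ n → j * m + m ≤ n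
  fits-head {j} {r} fits = ≤-trans (+-monoʳ-≤ (j * m) (m≤m+n m (r * m))) fits

  fits-tail : ∀ {j r} → j * m + suc r * m ≤ n → suc j * m + r * m ≤ n
  fits-tail {j} {r} = subst (_≤ n) (shift j r m)
    where
    shift : ∀ j r m → j * m + suc r * m ≡ suc j * m + r * m
    shift = solve-∀

  -- Densities are at most 1, so the invariant D < ρ + r leaves an interval for every further increment.
  iterate : ∀ r j ρ F → j * m + r * m ≤ n → D < ρ + r → α + nPatterns m ds ≤ ρ → IndependentFrom j F →
            1 ≤ card F → DensityAtLeast ρ D 𝒜 F → DenseCollection
  iterate zero    j ρ F _    D<ρ+0 _ _ 1≤|F| dense =
    contradiction (density≤1 𝒜 F 1≤|F| dense) (<⇒≱ (subst (D <_) (+-identityʳ ρ) D<ρ+0))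
  iterate (suc r) j ρ F fits D<ρ+r α+q≤ρ F-indep 1≤|F| dense =
    [ (λ (U , avoids , U-dense) → j * m , h , U , avoids , U-dense)
    , (λ (c , c-dense) → iterate r (suc j) (suc ρ) (slice c F) (fits-tail {j} {r} fits) (subst (D <_) (+-suc ρ r) D<ρ+r)
                                 (≤-trans α+q≤ρ (n≤1+n ρ)) (slice-independentFrom h c F-indep) (1≤|slice| c) c-dense)
    ]′ (density-increment-step 1≤|S| α+q≤ρ 1≤|F| dense)
    where
    h : j * m + m ≤ n
    h = fits-head {j} {r} fits
    open Interval m (j * m) h using (slice; card-slice; 1≤nOutside)
    open Step m (j * m) h S 𝒜 F (F-indep j ≤-refl h) α ρ D using (density-increment-step)
    1≤|slice| : ∀ c → 1 ≤ card (slice c F)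
    1≤|slice| c = subst (1 ≤_) (sym (card-slice c F (F-indep j ≤-refl h))) (1≤nOutside F (F-indep j ≤-refl h) 1≤|F|)

  dense-collection : ∀ {β} → α + nPatterns m ds ≤ β → suc D * m ≤ n → DensityAtLeast β D 𝒜 (λ _ → true) → DenseCollection
  dense-collection {β} α+q≤β fits dense =
    iterate (suc D) 0 β (λ _ → true) fits (≤-trans (n<1+n D) (m≤n+m (suc D) β)) α+q≤β (λ _ _ _ _ _ → refl)
            (subst (1 ≤_) (sym (card-full ds)) (m^n>0 2 (groundSize n ds))) dense

-- Each increment needs the gap α + q ≤ ρ, hence all numerators and the denominator are scaled by q.
dense-collection-fraction : ∀ {n s} {ds : Vec ℕ s} → All (1 ≤_) ds → ∀ m .{{_ : NonZero m}} (S : Family m ds) (𝒜 : Family n ds) →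
  ∀ {a c d} → 1 ≤ card S → a < c → suc (nPatterns m ds * d) * m ≤ n → c * 2 ^ groundSize n ds ≤ card 𝒜 * d →
  Located ds m (λ l h U → a * card (𝒞 m S l h U) ≤ card (𝒜 ∩F 𝒞 m S l h U) * d)
dense-collection-fraction {n} {ds = ds} ds-pos m S 𝒜 {a} {c} {d} 1≤|S| a<c fits dense =
  Located-map (λ _ → cancel-q) (dense-collection α+q≤β fits dense-full)
  where
  q = nPatterns m ds
  instance
    q≢0 : NonZero q
    q≢0 = m^n≢0 2 (groundSize m ds)
  open Iteration ds-pos m S 𝒜 (q * a) (q * d) 1≤|S| using (dense-collection)
  α+q≤β : q * a + q ≤ q * c
  α+q≤β = subst (_≤ q * c) (trans (*-suc q a) (+-comm q (q * a))) (*-monoʳ-≤ q a<c)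
  dense-full : DensityAtLeast (q * c) (q * d) 𝒜 (λ _ → true)
  dense-full = subst₂ _≤_ (trans (sym (*-assoc q c _)) (cong (q * c *_) (sym (card-full ds))))
                          (trans (cong (q *_) (*-comm (card 𝒜) d)) (trans (sym (*-assoc q d _))
                                 (cong (q * d *_) (card-cong (λ x → sym (Boolₚ.∧-identityʳ (𝒜 x)))))))
                          (*-monoʳ-≤ q dense)
  cancel-q : ∀ {X Y} → q * a * X ≤ q * d * Y → a * X ≤ Y * d
  cancel-q {X} {Y} le = *-cancelˡ-≤ q (subst₂ _≤_ (*-assoc q a X) (trans (*-assoc q d Y) (cong (q *_) (*-comm d Y))) le)

-- Rational densities as fractions

_≐_/1+_ : ℚ → ℕ → ℕ → Set
p ≐ a /1+ b = toℚᵘ p ≃ᵘ mkℚᵘ (⁺ a) b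

record PositiveFraction (p : ℚ) : Set where
  field
    numerator-1 denominator-1 : ℕ
    exact : p ≐ suc numerator-1 /1+ denominator-1

positive-fraction : ∀ {p} → 0ℚ <ℚ p → PositiveFraction p
positive-fraction {mkℚ (⁺ suc a) b _} _                 = record { numerator-1 = a ; denominator-1 = b ; exact = ℚᵘₚ.≃-refl }
positive-fraction {mkℚ (⁺ zero)  b _} (ℚ.*<* (+<+ ()))
positive-fraction {mkℚ -[1+ a ]  b _} (ℚ.*<* ())

toℚ-≐ : ∀ k → toℚ k ≐ k /1+ 0
toℚ-≐ k = ℚᵘₚ.≃-reflexive (cong toℚᵘ (ℚₚ.normalize-coprime (coprime-sym (1-coprimeTo k))))

≐-* : ∀ {p q a b c d} → p ≐ a /1+ b → q ≐ c /1+ d → (p *ℚ q) ≐ (a * c) /1+ (d + b * suc d)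
≐-* {p} {q} {a} {c = c} p≐ q≐ = ℚᵘₚ.≃-trans (ℚₚ.toℚᵘ-homo-* p q)
  (ℚᵘₚ.≃-trans (ℚᵘₚ.*-cong p≐ q≐) (ℚᵘₚ.≃-reflexive (cong (λ z → mkℚᵘ z _) (sym (ℤₚ.pos-* a c)))))

≐-- : ∀ {p q a b c d k} → p ≐ a /1+ b → q ≐ c /1+ d → a * suc d ≡ k + c * suc b → (p -ℚ q) ≐ k /1+ (d + b * suc d)
≐-- {p} {q} {a} {b} {c} {d} {k} p≐ q≐ a/b≡k+c/d = ℚᵘₚ.≃-trans (ℚₚ.toℚᵘ-homo-+ p (ℚ.- q))
  (ℚᵘₚ.≃-trans (ℚᵘₚ.+-cong p≐ (ℚᵘₚ.≃-trans (ℚₚ.toℚᵘ-homo‿- q) (ℚᵘₚ.-‿cong q≐)))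
               (ℚᵘₚ.≃-reflexive (cong (λ z → mkℚᵘ z _) numerator)))
  where
  numerator : ⁺ a ℤ.* ⁺ suc d ℤ.+ ℤ.- (⁺ c) ℤ.* ⁺ suc b ≡ ⁺ k
  numerator = begin
    ⁺ a ℤ.* ⁺ suc d ℤ.+ ℤ.- (⁺ c) ℤ.* ⁺ suc b            ≡⟨ cong (λ z → z ℤ.+ ℤ.- (⁺ c) ℤ.* ⁺ suc b) (sym (ℤₚ.pos-* a (suc d))) ⟩
    ⁺ (a * suc d) ℤ.+ ℤ.- (⁺ c) ℤ.* ⁺ suc b              ≡⟨ cong (λ z → ⁺ z ℤ.+ ℤ.- (⁺ c) ℤ.* ⁺ suc b) a/b≡k+c/d ⟩
    ⁺ (k + c * suc b) ℤ.+ ℤ.- (⁺ c) ℤ.* ⁺ suc b          ≡⟨ cong (λ z → z ℤ.+ ℤ.- (⁺ c) ℤ.* ⁺ suc b)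
                                                              (trans (ℤₚ.pos-+ k (c * suc b)) (cong (λ z → ⁺ k ℤ.+ z) (ℤₚ.pos-* c (suc b)))) ⟩
    ⁺ k ℤ.+ ⁺ c ℤ.* ⁺ suc b ℤ.+ ℤ.- (⁺ c) ℤ.* ⁺ suc b    ≡⟨ cancel (⁺ k) (⁺ c) (⁺ suc b) ⟩
    ⁺ k                                                  ∎
    where
    open ≡-Reasoning
    cancel : ∀ x y z → x ℤ.+ y ℤ.* z ℤ.+ ℤ.- y ℤ.* z ≡ x
    cancel = ℤ-Solver.solve-∀

≐-≤⇔ : ∀ {p q a b c d} → p ≐ a /1+ b → q ≐ c /1+ d → (p ≤ℚ q) ⇔ (a * suc d ≤ c * suc b)
≐-≤⇔ {a = a} {b} {c} {d} p≐ q≐ = mk⇔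
  (λ p≤q → from-fraction (ℚᵘₚ.≤-respʳ-≃ q≐ (ℚᵘₚ.≤-respˡ-≃ p≐ (ℚₚ.toℚᵘ-mono-≤ p≤q))))
  (λ le → ℚₚ.toℚᵘ-cancel-≤ (ℚᵘₚ.≤-respʳ-≃ (ℚᵘₚ.≃-sym q≐) (ℚᵘₚ.≤-respˡ-≃ (ℚᵘₚ.≃-sym p≐)
                             (*≤* (subst₂ ℤ._≤_ (ℤₚ.pos-* a (suc d)) (ℤₚ.pos-* c (suc b)) (+≤+ le))))))
  where
  from-fraction : mkℚᵘ (⁺ a) b ≤ᵘ mkℚᵘ (⁺ c) d → a * suc d ≤ c * suc b
  from-fraction (*≤* le) = ℤₚ.drop‿+≤+ (subst₂ ℤ._≤_ (sym (ℤₚ.pos-* a (suc d))) (sym (ℤₚ.pos-* c (suc b))) le)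

≐-<⇒ : ∀ {p q a b c d} → p ≐ a /1+ b → q ≐ c /1+ d → p <ℚ q → a * suc d < c * suc b
≐-<⇒ {a = a} {b} {c} {d} p≐ q≐ p<q = from-fraction (ℚᵘₚ.<-respʳ-≃ q≐ (ℚᵘₚ.<-respˡ-≃ p≐ (ℚₚ.toℚᵘ-mono-< p<q)))
  where
  from-fraction : mkℚᵘ (⁺ a) b <ᵘ mkℚᵘ (⁺ c) d → a * suc d < c * suc b
  from-fraction (*<* lt) = ℤₚ.drop‿+<+ (subst₂ ℤ._<_ (sym (ℤₚ.pos-* a (suc d))) (sym (ℤₚ.pos-* c (suc b))) lt)

≐-*toℚ-≤⇔ : ∀ {p a b} → p ≐ a /1+ b → ∀ X Y → (p *ℚ toℚ X ≤ℚ toℚ Y) ⇔ (a * X ≤ Y * suc b)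
≐-*toℚ-≤⇔ {p} {a} {b} p≐ X Y = mk⇔
  (λ le → subst₂ _≤_ (*-identityʳ (a * X)) (cong (λ t → Y * suc t) (*-identityʳ b)) (fractions .to le))
  (λ le → fractions .from (subst₂ _≤_ (sym (*-identityʳ (a * X))) (cong (λ t → Y * suc t) (sym (*-identityʳ b))) le))
  where
  fractions = ≐-≤⇔ (≐-* p≐ (toℚ-≐ X)) (toℚ-≐ Y)

density-transfers-to-some-𝒞 : ∀ {s} {ds : Vec ℕ s} → All (1 ≤_) ds → ∀ m .{{_ : NonZero m}} {δ} → 0ℚ <ℚ δ →
  (ε : ℚ) → 0ℚ <ℚ ε → ε <ℚ δ →
  Σ ℕ λ N → (n : ℕ) → N ≤ n → (𝒜m : Family m ds) → 1 ≤ card 𝒜m → (𝒜 : Family n ds) →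
    δ *ℚ toℚ (2 ^ groundSize n ds) ≤ℚ toℚ (card 𝒜) →
    Located ds m (λ l h U → (δ -ℚ ε) *ℚ toℚ (card (𝒞 m 𝒜m l h U)) ≤ℚ toℚ (card (𝒜 ∩F 𝒞 m 𝒜m l h U)))
density-transfers-to-some-𝒞 {ds = ds} ds-pos m {δ} δ>0 ε ε>0 ε<δ =
  suc (nPatterns m ds * (suc b * suc e)) * m ,
  λ n N≤n 𝒜m 1≤|𝒜m| 𝒜 dense →
    Located-map (λ {l} {h} {U} _ → ≐-*toℚ-≤⇔ δ-ε≐ (card (𝒞 m 𝒜m l h U)) (card (𝒜 ∩F 𝒞 m 𝒜m l h U)) .from)
                (dense-collection-fraction ds-pos m 𝒜m 𝒜 1≤|𝒜m| k<ae N≤n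
                  (scale-≤ {suc a} {2 ^ groundSize n ds} {card 𝒜} {suc b} (suc e) (≐-*toℚ-≤⇔ δ≐ (2 ^ groundSize n ds) (card 𝒜) .to dense)))
  where
  open PositiveFraction (positive-fraction δ>0) renaming (numerator-1 to a; denominator-1 to b; exact to δ≐)
  open PositiveFraction (positive-fraction ε>0) renaming (numerator-1 to c; denominator-1 to e; exact to ε≐)
  cb<ae : suc c * suc b < suc a * suc e
  cb<ae = ≐-<⇒ ε≐ δ≐ ε<δ
  k = suc a * suc e ∸ suc c * suc b
  ae≡k+cb : suc a * suc e ≡ k + suc c * suc b
  ae≡k+cb = sym (m∸n+n≡m (<⇒≤ cb<ae))
  k<ae : k < suc a * suc e
  k<ae = subst (k <_) (sym ae≡k+cb) (m<m+n k (s≤s z≤n))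
  δ-ε≐ : (δ -ℚ ε) ≐ k /1+ (e + b * suc e)
  δ-ε≐ = ≐-- δ≐ ε≐ ae≡k+cb

some-𝒞-meets-𝒜-twice : ∀ {s} {ds : Vec ℕ s} → All (1 ≤_) ds → ∀ m .{{_ : NonZero m}} {δ} → 0ℚ <ℚ δ →
  Σ ℕ λ N′ → (n : ℕ) → N′ ≤ n → (𝒜m : Family m ds) → toℚ 4 <ℚ δ *ℚ toℚ (card 𝒜m) → (𝒜 : Family n ds) →
    δ *ℚ toℚ (2 ^ groundSize n ds) ≤ℚ toℚ (card 𝒜) →
    Located ds m (λ l h U → 2 ≤ card (𝒜 ∩F 𝒞 m 𝒜m l h U))
some-𝒞-meets-𝒜-twice {ds = ds} ds-pos m {δ} δ>0 =
  suc (nPatterns m ds * (suc b * 2)) * m ,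
  λ n N′≤n 𝒜m 4<δ|𝒜m| 𝒜 dense →
    let 4b<a|𝒜m| = large-pattern-family 𝒜m 4<δ|𝒜m| in
    Located-map (λ {l} {h} {U} avoids → two-hits 𝒜m 𝒜 4b<a|𝒜m| (card-𝒞 m l h 𝒜m avoids))
                (dense-collection-fraction ds-pos m 𝒜m 𝒜 (1≤m*n⇒1≤n (suc a) (≤-trans (s≤s z≤n) 4b<a|𝒜m|))
                  (m<m*n (suc a) 2 ≤-refl) N′≤n
                  (scale-≤ {suc a} {2 ^ groundSize n ds} {card 𝒜} {suc b} 2 (≐-*toℚ-≤⇔ δ≐ (2 ^ groundSize n ds) (card 𝒜) .to dense)))
  where
  open PositiveFraction (positive-fraction δ>0) renaming (numerator-1 to a; denominator-1 to b; exact to δ≐)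
  open Interval using (card-𝒞)
  large-pattern-family : ∀ (𝒜m : Family m ds) → toℚ 4 <ℚ δ *ℚ toℚ (card 𝒜m) → 4 * suc b < suc a * card 𝒜m
  large-pattern-family 𝒜m 4<δ|𝒜m| =
    subst₂ _<_ (cong (λ t → 4 * suc t) (*-identityʳ b)) (*-identityʳ (suc a * card 𝒜m))
           (≐-<⇒ (toℚ-≐ 4) (≐-* δ≐ (toℚ-≐ (card 𝒜m))) 4<δ|𝒜m|)
  two-hits : ∀ {n} (𝒜m : Family m ds) (𝒜 : Family n ds) {𝒞′ : Family n ds} → 4 * suc b < suc a * card 𝒜m → card 𝒞′ ≡ card 𝒜m →
             suc a * card 𝒞′ ≤ card (𝒜 ∩F 𝒞′) * (suc b * 2) → 2 ≤ card (𝒜 ∩F 𝒞′)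
  two-hits 𝒜m 𝒜 {𝒞′} 4b<a|𝒜m| |𝒞′|≡|𝒜m| dense-𝒞′ = <⇒≤ (*-cancelˡ-< (suc b * 2) 2 _ (begin-strict
    suc b * 2 * 2                   ≡⟨ *-assoc (suc b) 2 2 ⟩
    suc b * 4                       ≡⟨ *-comm (suc b) 4 ⟩
    4 * suc b                       <⟨ 4b<a|𝒜m| ⟩
    suc a * card 𝒜m                 ≡⟨ cong (suc a *_) |𝒞′|≡|𝒜m| ⟨
    suc a * card 𝒞′                 ≤⟨ dense-𝒞′ ⟩
    card (𝒜 ∩F 𝒞′) * (suc b * 2)    ≡⟨ *-comm (card (𝒜 ∩F 𝒞′)) _ ⟩
    suc b * 2 * card (𝒜 ∩F 𝒞′)      ∎))
    where open ≤-Reasoning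

mainTheorem6 : (s : ℕ) → 1 ≤ s → (ds : Vec ℕ s) → All (λ d → 1 ≤ d) ds →
    (m : ℕ) → 1 ≤ m → (δ : ℚ) → 0ℚ <ℚ δ →
    ((ε : ℚ) → 0ℚ <ℚ ε → ε <ℚ δ →
      Σ ℕ (λ N → (n : ℕ) → N ≤ n →
        (𝒜m : Family m ds) → 1 ≤ card 𝒜m →
        (𝒜 : Family n ds) → δ *ℚ toℚ (2 ^ groundSize n ds) ≤ℚ toℚ (card 𝒜) →
        Σ ℕ (λ l → Σ (l + m ≤ n) (λ h → Σ (Config n ds) (λ U →
          ((p : Point n ds) → T (inIᵇ l m p) → mem U p ≡ false) ×
          ((δ -ℚ ε) *ℚ toℚ (card (𝒞 m 𝒜m l h U))
            ≤ℚ toℚ (card (𝒜 ∩F 𝒞 m 𝒜m l h U)))))))) ×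
    Σ ℕ (λ N′ → (n : ℕ) → N′ ≤ n →
        (𝒜m : Family m ds) → toℚ 4 <ℚ δ *ℚ toℚ (card 𝒜m) →
        (𝒜 : Family n ds) → δ *ℚ toℚ (2 ^ groundSize n ds) ≤ℚ toℚ (card 𝒜) →
        Σ ℕ (λ l → Σ (l + m ≤ n) (λ h → Σ (Config n ds) (λ U →
          ((p : Point n ds) → T (inIᵇ l m p) → mem U p ≡ false) ×
          (2 ≤ card (𝒜 ∩F 𝒞 m 𝒜m l h U))))))
mainTheorem6 _ _ ds ds-pos m 1≤m δ δ>0 =
  density-transfers-to-some-𝒞 ds-pos m {{>-nonZero 1≤m}} δ>0 , some-𝒞-meets-𝒜-twice ds-pos m {{>-nonZero 1≤m}} δ>0
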